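{- Let $n\ge3$ be odd, $k=n-1$, and let $Z_d(a)$, $a=(a_1,\dots,a_n)\in\mathbb{R}^n$, be the homogeneous degree-$d$ polynomial defined below for type $D_n$. Then: (a) $Z_d$ is invariant under each coordinate reflection $a_i\mapsto -a_i$; in other words $Z_d$ is a polynomial in $a_1^2,\ldots,a_n^2$. (b) $Z_d$ contains no monomial (with nonzero coefficient) in which all the exponents of $a_1,\dots,a_n$ are positive. (c) $Z_d$ contains no monomial (with nonzero coefficient) in which two of the exponents are equal.
   Context: Type $D_n$: positive pseudo-roots $\Phi^+=\{(e_i\pm e_j)/\sqrt2:1\le i<j\le n\}$ in $\mathbb{R}^n$. Let $c_m=(-1)^m\binom{1/2}{m}$ (the case $(n-k)/2=1/2$), $T_{2m+k}(x_1,\dots,x_k)=c_m\sum_{r_1+\cdots+r_k=m}\binom{m}{r_1,\ldots,r_k}\prod_{i=1}^k\frac{x_i^{2r_i+1}}{2r_i+1}$ for $m\ge0$, and $T_d=0$ for $d<k$ or $d$ odd. A maximal matching $M$ of $\{1,\dots,n\}$ consists of $(n-1)/2$ disjoint pairs $(i_1<j_1),\dots,(i_{m}<j_{m})$ leaving one isolated vertex $p$; a crossing is a pair of edges $\{a<b\},\{c<d\}$ with $a<c<b<d$, $\mathrm{cross}(M)$ is their number, and $(-1)^M=(-1)^{\mathrm{cross}(M)+p-1}$. For such $M$ let $f^\pm_r=(e_{i_r}\pm e_{j_r})/\sqrt2$ and $Z_d(a)=\sum_M(-1)^M\,T_d\big((f_1^+,a),(f_1^-,a),\dots,(f_m^+,a),(f_m^-,a)\big)$,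 summing over all maximal matchings $M$ of $\{1,\dots,n\}$ ($T_d$ is symmetric, so the order of arguments is irrelevant). -}

module Defs where

open import Data.Bool using (Bool; true; false; if_then_else_; _∧_)
open import Data.Nat as ℕ using (ℕ; zero; suc; _∸_; _^_; _<ᵇ_; _≡ᵇ_)
open import Data.Nat.DivMod using (_/_; _%_)
open import Data.Integer using (+_)
open import Data.Rational as Q using (ℚ; 0ℚ; 1ℚ)
open import Data.Fin as F using (Fin; toℕ)
open import Data.List as L using (List; []; _∷_; _++_; concatMap; filter; allFin; upTo; foldr; length; zipWith)
open import Data.Vec as V using (Vec)
open import Data.Vec.Properties using (≡-dec)
open import Data.Product using (_×_; _,_)
open import Relation.Nullary.Decidable using (does; ⌊_⌋)
open import Relation.Binary.PropositionalEquality using (_≡_)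

allB : {A : Set} → (A → Bool) → List A → Bool
allB p = foldr (λ x b → p x ∧ b) true

sumN : List ℕ → ℕ
sumN = foldr ℕ._+_ 0

ℕtoℚ : ℕ → ℚ
ℕtoℚ n = (+ n) Q./ 1

-- 1/n as a rational (only used with n ≠ 0; 1/0 := 0 is never used)
inv : ℕ → ℚ
inv zero    = 0ℚ
inv (suc n) = (+ 1) Q./ suc n

prodQ : List ℚ → ℚ
prodQ = foldr Q._*_ 1ℚ

sumQ : List ℚ → ℚ
sumQ = foldr Q._+_ 0ℚ

signQ : ℕ → ℚ
signQ e = if (e % 2) ≡ᵇ 0 then 1ℚ else Q.- 1ℚ

gbinom : ℚ → ℕ → ℚ
gbinom q m = prodQ (L.map (λ j → q Q.- ℕtoℚ j) (upTo m)) Q.* inv (m ℕ.!)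

half : ℚ
half = (+ 1) Q./ 2

-- c_m = (-1)^m binom(1/2, m)   (the case (n-k)/2 = 1/2)
cHalf : ℕ → ℚ
cHalf m = signQ m Q.* gbinom half m

multinom : ℕ → List ℕ → ℚ
multinom m rs = ℕtoℚ (m ℕ.!) Q.* prodQ (L.map (λ r → inv (r ℕ.!)) rs)

comps : ℕ → ℕ → List (List ℕ)
comps m zero    = if m ≡ᵇ 0 then ([] ∷ []) else []
comps m (suc k) = concatMap (λ r → L.map (r ∷_) (comps (m ∸ r) k)) (upTo (suc m))

-- Two representations denote the same polynomial iff all coefficients agree.

Mono : ℕ → Set
Mono n = Vec ℕ n

Poly : ℕ → Set
Poly n = List (ℚ × Mono n)

module _ {n : ℕ} where

  zeroP : Poly n
  zeroP = []

  oneP : Poly n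
  oneP = (1ℚ , V.replicate n 0) ∷ []

  var : Fin n → Poly n
  var i = (1ℚ , V.tabulate (λ j → if does (i F.≟ j) then 1 else 0)) ∷ []

  _⊕_ : Poly n → Poly n → Poly n
  _⊕_ = _++_

  scale : ℚ → Poly n → Poly n
  scale c = L.map (λ { (q , e) → (c Q.* q , e) })

  _⊖_ : Poly n → Poly n → Poly n
  p ⊖ r = p ⊕ scale (Q.- 1ℚ) r

  _⊗_ : Poly n → Poly n → Poly n
  p ⊗ r = concatMap (λ { (a , e) → L.map (λ { (b , f) → (a Q.* b , V.zipWith ℕ._+_ e f) }) r }) p

  powP : Poly n → ℕ → Poly n
  powP p zero    = oneP
  powP p (suc k) = p ⊗ powP p k

  sumP : List (Poly n) → Poly n
  sumP = foldr _⊕_ zeroP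

  prodP : List (Poly n) → Poly n
  prodP = foldr _⊗_ oneP

  coeff : Poly n → Mono n → ℚ
  coeff p e = sumQ (L.map (λ { (q , f) → if does (≡-dec ℕ._≟_ e f) then q else 0ℚ }) p)

  reflect : Fin n → Poly n → Poly n
  reflect i = L.map (λ { (q , e) → (signQ (V.lookup e i) Q.* q , e) })

Tpoly : {n : ℕ} → ℕ → List (Poly n) → Poly n
Tpoly {n} d xs =
  if d <ᵇ k then zeroP
  else if (d % 2) ≡ᵇ 1 then zeroP
  else scale (cHalf m)
         (sumP (L.map (λ rs → scale (multinom m rs)
                                (prodP (zipWith term rs xs)))
                      (comps m k)))
  where
  k = length xs
  m = (d ∸ k) / 2
  term : ℕ → Poly n → Poly n
  term r x = scale (inv (suc (2 ℕ.* r))) (powP x (suc (2 ℕ.* r)))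

-- Maximal matchings of {1..n} (n odd) = involutions σ of Fin n with exactly
-- one fixed point; edge {i<j} ⇔ σ i = j, i < j.

allVecs : {A : Set} → List A → (m : ℕ) → List (Vec A m)
allVecs xs zero    = V.[] ∷ []
allVecs xs (suc m) = concatMap (λ x → L.map (x V.∷_) (allVecs xs m)) xs

module _ {n : ℕ} (σ : Vec (Fin n) n) where

  app : Fin n → Fin n
  app = V.lookup σ

  fixedPoints : List (Fin n)
  fixedPoints = filter (λ i → app i F.≟ i) (allFin n)

  isInvolution : Bool
  isInvolution = allB (λ i → does (app (app i) F.≟ i)) (allFin n)

  isMaxMatching : Bool
  isMaxMatching = isInvolution ∧ (length fixedPoints ≡ᵇ 1)

  leftEnds : List (Fin n)
  leftEnds = L.filterᵇ (λ i → toℕ i <ᵇ toℕ (app i)) (allFin n)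

  cross : ℕ
  cross = length (L.filterᵇ
    (λ { (a , c) → (toℕ a <ᵇ toℕ c) ∧ ((toℕ c <ᵇ toℕ (app a)) ∧ (toℕ (app a) <ᵇ toℕ (app c))) })
    (L.cartesianProduct leftEnds leftEnds))

  -- (-1)^M = (-1)^(cross(M) + p - 1); p is 1-indexed, so p - 1 = toℕ p.
  -- For a maximal matching, fixedPoints = [p], so the sum below is toℕ p.
  matchingSign : ℚ
  matchingSign = signQ (cross ℕ.+ sumN (L.map toℕ fixedPoints))

  -- the linear forms √2 (f_r^±, a) = a_{i_r} ± a_{j_r}
  forms : List (Poly n)
  forms = concatMap (λ i → (var i ⊕ var (app i)) ∷ (var i ⊖ var (app i)) ∷ []) leftEnds

maxMatchings : (n : ℕ) → List (Vec (Fin n) n)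
maxMatchings n = L.filterᵇ isMaxMatching (allVecs (allFin n) n)

-- Z_d(a) = Σ_M (-1)^M T_d((f_1^+,a),(f_1^-,a),...)
-- Since (f_r^±,a) = (a_i ± a_j)/√2 and every term of T_d is a product of
-- linear forms of total degree d (d even whenever T_d ≠ 0, as k = n-1 is even),
-- T_d((f,a)) = 2^{-d/2} T_d(a_i ± a_j).

Z : (n d : ℕ) → Poly n
Z n d = scale (inv (2 ^ (d / 2)))
          (sumP (L.map (λ σ → scale (matchingSign σ) (Tpoly d (forms σ))) (maxMatchings n)))

-- Z_d is a signed sum over maximal matchings M of T_d evaluated at the forms a_i ± a_j of the edges {i < j} of M.
-- (a) Reflecting a_i fixes every form if i is unmatched; otherwise it maps the pair (a_l + a_m , a_l - a_m) of the
-- edge through i to (-(a_l - a_m) , -(a_l + a_m)) or to (a_l - a_m , a_l + a_m). Since T_d is symmetric and odd in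
-- each argument, every summand is invariant.
-- (b) The unmatched vertex p of M occurs in none of its forms, so no monomial of the summand of M contains a_p.
-- (c) Exchanging a_k and a_(k+1) conjugates the matchings by the transposition (k k+1). A matching pairing k with
-- k+1 is fixed and one of its forms changes sign; any other is sent to a matching of opposite sign (-1)^M, because
-- either the unmatched vertex moves by one or exactly one crossing appears or disappears. So Z_d is alternating
-- under adjacent transpositions, and its coefficients vanish on exponent vectors with a repeated entry.

module Submission where

open import Defs
open import Algebra.Bundles using (CommutativeMonoid)
import Algebra.Properties.CommutativeSemigroup as CommSemigroupProperties
open import Data.Bool using (Bool; true; false; if_then_else_; _∧_; _xor_; T; T?)
open import Data.Bool.Properties using (T-∧; T-≡; xor-same; xor-identityʳ)
open import Data.Empty using (⊥-elim)
open import Data.Unit using (tt)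
open import Data.Fin as F using (Fin; toℕ)
import Data.Fin.Properties as FP
open import Data.List as L using (List; []; _∷_; [_]; _++_; concat; concatMap; length; zipWith; filterᵇ; allFin; upTo; cartesianProduct)
import Data.List.Properties as LP
open import Data.List.Membership.Propositional using (_∈_; _∉_; find; lose)
open import Data.List.Membership.Propositional.Properties
  using (∈-allFin; ∈-cartesianProduct⁺; ∈-cartesianProduct⁻; ∈-concatMap⁺; ∈-concatMap⁻; ∈-filter⁺; ∈-filter⁻; ∈-map⁺; ∈-map⁻; ∈-upTo⁺; ∈-upTo⁻)
open import Data.List.Membership.Propositional.Properties.WithK using (unique∧set⇒bag)
open import Data.List.Relation.Binary.BagAndSetEquality using (∼bag⇒↭)
open import Data.List.Relation.Binary.Permutation.Propositional
  using (_↭_; prep; swap; ↭-refl; ↭-sym; ↭-trans; ↭-reflexive; module PermutationReasoning)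
open import Data.List.Relation.Binary.Permutation.Propositional.Properties using (map⁺; ++⁺; ++⁺ˡ; shifts; ↭-length; filter-↭)
open import Data.List.Relation.Binary.Pointwise as Pointwise using (Pointwise; []; _∷_)
open import Data.List.Relation.Unary.All as All using (All; []; _∷_)
import Data.List.Relation.Unary.All.Properties as AllP
open import Data.List.Relation.Unary.AllPairs using ([]; _∷_)
open import Data.List.Relation.Unary.Any using (Any; here; there)
open import Data.List.Relation.Unary.Unique.Propositional using (Unique)
import Data.List.Relation.Unary.Unique.Propositional.Properties as UniqueP
open import Data.Nat as ℕ using (ℕ; zero; suc; _∸_; _<ᵇ_; _≡ᵇ_; _≤_; _<_; s≤s; z≤n)
import Data.Nat.Properties as ℕP
open import Data.Nat.DivMod using (_%_)
open import Data.Product using (∃; _×_; _,_; proj₁; proj₂)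
open import Data.Rational as ℚ using (ℚ; 0ℚ; 1ℚ)
import Data.Rational.Properties as ℚP
open import Data.Sum using (_⊎_; inj₁; inj₂)
open import Data.Vec as V using (Vec; lookup)
import Data.Vec.Properties as VP
open import Function using (_∘_; mk⇔; Equivalence)
open import Relation.Binary.Definitions using (tri<; tri≈; tri>)
open import Relation.Binary.PropositionalEquality hiding ([_])
open import Relation.Nullary using (Dec; yes; no; does; ¬_)
open import Relation.Nullary.Decidable using (dec-true; dec-false)

open CommSemigroupProperties (CommutativeMonoid.commutativeSemigroup ℚP.*-1-commutativeMonoid)
  using () renaming (interchange to *-interchange; x∙yz≈y∙xz to *-left-comm)

private variable
  A B C : Set

concatMap⁺ : (f : A → List B) {xs ys : List A} → xs ↭ ys → concatMap f xs ↭ concatMap f ys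
concatMap⁺ f _↭_.refl         = ↭-refl
concatMap⁺ f (prep x p)       = ++⁺ˡ (f x) (concatMap⁺ f p)
concatMap⁺ f (swap x y p)     = ↭-trans (shifts (f x) (f y)) (++⁺ˡ (f y) (++⁺ˡ (f x) (concatMap⁺ f p)))
concatMap⁺ f (_↭_.trans p q)  = ↭-trans (concatMap⁺ f p) (concatMap⁺ f q)

concatMap-cong-↭ : {f g : A → List B} (xs : List A) → All (λ x → f x ↭ g x) xs →
                   concatMap f xs ↭ concatMap g xs
concatMap-cong-↭ []       []       = ↭-refl
concatMap-cong-↭ (x ∷ xs) (p ∷ ps) = ++⁺ p (concatMap-cong-↭ xs ps)

concat⁺ : {xss yss : List (List A)} → xss ↭ yss → concat xss ↭ concat yss
concat⁺ _↭_.refl        = ↭-refl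
concat⁺ (prep xs p)     = ++⁺ˡ xs (concat⁺ p)
concat⁺ (swap xs ys p)  = ↭-trans (shifts xs ys) (++⁺ˡ ys (++⁺ˡ xs (concat⁺ p)))
concat⁺ (_↭_.trans p q) = ↭-trans (concat⁺ p) (concat⁺ q)

unique-↭ : {xs ys : List A} → Unique xs → Unique ys →
           (∀ {z} → z ∈ xs → z ∈ ys) → (∀ {z} → z ∈ ys → z ∈ xs) → xs ↭ ys
unique-↭ ux uy f g = ∼bag⇒↭ (unique∧set⇒bag ux uy (mk⇔ f g))

unique-focus : {x : A} {xs : List A} → Unique xs → x ∈ xs →
               ∃ λ ys → xs ↭ x ∷ ys × (∀ {y} → y ∈ ys → y ∈ xs × y ≢ x)
unique-focus {xs = x ∷ xs} (x∉ ∷ _) (here refl) =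
  xs , ↭-refl , λ y∈ → there y∈ , λ { refl → All.lookup x∉ y∈ refl }
unique-focus {xs = z ∷ xs} (z∉ ∷ u) (there x∈) with unique-focus u x∈
... | ys , xs↭ , ys⊆ =
  z ∷ ys , ↭-trans (prep z xs↭) (swap z _ ↭-refl) , λ
    { (here refl) → here refl , λ { refl → All.lookup z∉ x∈ refl }
    ; (there y∈) → there (proj₁ (ys⊆ y∈)) , proj₂ (ys⊆ y∈) }

unique-taggedUnion : (c : A → B → C) → (∀ {h h' t t'} → c h t ≡ c h' t' → h ≡ h' × t ≡ t') →
                     (g : A → List B) (hs : List A) → Unique hs → (∀ h → Unique (g h)) →
                     Unique (concatMap (λ h → L.map (c h) (g h)) hs)
unique-taggedUnion c c-inj g []       _          _  = []
unique-taggedUnion c c-inj g (h ∷ hs) (h∉ ∷ uhs) ug =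
  UniqueP.++⁺ (UniqueP.map⁺ (λ eq → proj₂ (c-inj eq)) (ug h)) (unique-taggedUnion c c-inj g hs uhs ug) disjoint
  where
  disjoint : ∀ {v} → ¬ (v ∈ L.map (c h) (g h) × v ∈ concatMap (λ h → L.map (c h) (g h)) hs)
  disjoint (v∈ , v∈') with _ , _ , refl ← ∈-map⁻ (c h) v∈ = away hs h∉ (∈-concatMap⁻ (λ h → L.map (c h) (g h)) {xs = hs} v∈')
    where
    away : ∀ {t} hs → All (h ≢_) hs → ¬ Any (λ h' → c h t ∈ L.map (c h') (g h')) hs
    away (h' ∷ _)  (h≢ ∷ _)   (here w) with _ , _ , eq ← ∈-map⁻ (c h') w = h≢ (proj₁ (c-inj eq))
    away (_ ∷ hs)  (_ ∷ h≢s)  (there w) = away hs h≢s w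

comps-unique : ∀ m k → Unique (comps m k)
comps-unique zero    zero    = [] ∷ []
comps-unique (suc m) zero    = []
comps-unique m       (suc k) = unique-taggedUnion L._∷_ LP.∷-injective (λ r → comps (m ∸ r) k) (upTo (suc m))
                                 (UniqueP.upTo⁺ (suc m)) (λ r → comps-unique (m ∸ r) k)

∈-comps⁻ : ∀ m k {rs} → rs ∈ comps m k → length rs ≡ k × sumN rs ≡ m
∈-comps⁻ zero    zero    (here refl) = refl , refl
∈-comps⁻ m       (suc k) rs∈
  with r , r∈ , rs∈' ← find (∈-concatMap⁻ (λ r → L.map (r ∷_) (comps (m ∸ r) k)) {xs = upTo (suc m)} rs∈)
  with rs , rs∈ , refl ← ∈-map⁻ (r ∷_) rs∈'
  with len , total ← ∈-comps⁻ (m ∸ r) k rs∈ =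
  cong suc len , trans (cong (r ℕ.+_) total) (ℕP.m+[n∸m]≡n (ℕP.≤-pred (∈-upTo⁻ r∈)))

∈-comps⁺ : ∀ {m k} rs → length rs ≡ k → sumN rs ≡ m → rs ∈ comps m k
∈-comps⁺ []       refl refl = here refl
∈-comps⁺ (r ∷ rs) refl refl =
  ∈-concatMap⁺ (λ r' → L.map (r' ∷_) (comps (sumN (r ∷ rs) ∸ r') (length rs))) {xs = upTo (suc (sumN (r ∷ rs)))}
    (lose (∈-upTo⁺ (s≤s (ℕP.m≤m+n r (sumN rs))))
          (∈-map⁺ (r ∷_) (∈-comps⁺ rs refl (sym (ℕP.m+n∸m≡n r (sumN rs))))))

swapAt : ℕ → List A → List A
swapAt zero    (x ∷ y ∷ xs) = y ∷ x ∷ xs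
swapAt zero    xs           = xs
swapAt (suc t) []           = []
swapAt (suc t) (x ∷ xs)     = x ∷ swapAt t xs

swapAt-length-++ : ∀ (P : List A) x y S → swapAt (length P) (P ++ x ∷ y ∷ S) ≡ P ++ y ∷ x ∷ S
swapAt-length-++ []      x y S = refl
swapAt-length-++ (z ∷ P) x y S = cong (z ∷_) (swapAt-length-++ P x y S)

swapAt-involutive : ∀ t (xs : List A) → swapAt t (swapAt t xs) ≡ xs
swapAt-involutive zero    []           = refl
swapAt-involutive zero    (x ∷ [])     = refl
swapAt-involutive zero    (x ∷ y ∷ xs) = refl
swapAt-involutive (suc t) []           = refl
swapAt-involutive (suc t) (x ∷ xs)     = cong (x ∷_) (swapAt-involutive t xs)

swapAt-injective : ∀ t {xs ys : List A} → swapAt t xs ≡ swapAt t ys → xs ≡ ys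
swapAt-injective t {xs} {ys} eq =
  trans (sym (swapAt-involutive t xs)) (trans (cong (swapAt t) eq) (swapAt-involutive t ys))

length-swapAt : ∀ t (xs : List A) → length (swapAt t xs) ≡ length xs
length-swapAt zero    []           = refl
length-swapAt zero    (x ∷ [])     = refl
length-swapAt zero    (x ∷ y ∷ xs) = refl
length-swapAt (suc t) []           = refl
length-swapAt (suc t) (x ∷ xs)     = cong suc (length-swapAt t xs)

sumN-swapAt : ∀ t (xs : List ℕ) → sumN (swapAt t xs) ≡ sumN xs
sumN-swapAt zero    []           = refl
sumN-swapAt zero    (x ∷ [])     = refl
sumN-swapAt zero    (x ∷ y ∷ xs) = +-left-comm y x (sumN xs)
  where open CommSemigroupProperties ℕP.+-commutativeSemigroup renaming (x∙yz≈y∙xz to +-left-comm)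
sumN-swapAt (suc t) []           = refl
sumN-swapAt (suc t) (x ∷ xs)     = cong (x ℕ.+_) (sumN-swapAt t xs)

map-swapAt : (f : A → B) → ∀ t (xs : List A) → L.map f (swapAt t xs) ≡ swapAt t (L.map f xs)
map-swapAt f zero    []           = refl
map-swapAt f zero    (x ∷ [])     = refl
map-swapAt f zero    (x ∷ y ∷ xs) = refl
map-swapAt f (suc t) []           = refl
map-swapAt f (suc t) (x ∷ xs)     = cong (f x ∷_) (map-swapAt f t xs)

zipWith-swapAt : (f : A → B → C) → ∀ t (xs : List A) (ys : List B) → length xs ≡ length ys →
                 zipWith f (swapAt t xs) (swapAt t ys) ≡ swapAt t (zipWith f xs ys)
zipWith-swapAt f zero    []           []           _  = refl
zipWith-swapAt f zero    (x ∷ [])     (y ∷ [])     _  = refl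
zipWith-swapAt f zero    (x ∷ x' ∷ xs) (y ∷ y' ∷ ys) _ = refl
zipWith-swapAt f (suc t) []           []           _  = refl
zipWith-swapAt f (suc t) (x ∷ xs)     (y ∷ ys)     eq = cong (f x y ∷_) (zipWith-swapAt f t xs ys (ℕP.suc-injective eq))

swapAt-comps : ∀ t m k → L.map (swapAt t) (comps m k) ↭ comps m k
swapAt-comps t m k = unique-↭ (UniqueP.map⁺ (swapAt-injective t) (comps-unique m k)) (comps-unique m k) ⊆ ⊇
  where
  ⊆ : ∀ {rs} → rs ∈ L.map (swapAt t) (comps m k) → rs ∈ comps m k
  ⊆ rs∈ with rs , rs∈ , refl ← ∈-map⁻ (swapAt t) rs∈ with len , total ← ∈-comps⁻ m k rs∈ =
    ∈-comps⁺ _ (trans (length-swapAt t rs) len) (trans (sumN-swapAt t rs) total)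
  ⊇ : ∀ {rs} → rs ∈ comps m k → rs ∈ L.map (swapAt t) (comps m k)
  ⊇ {rs} rs∈ with len , total ← ∈-comps⁻ m k rs∈ =
    subst (_∈ L.map (swapAt t) (comps m k)) (swapAt-involutive t rs)
      (∈-map⁺ (swapAt t) (∈-comps⁺ _ (trans (length-swapAt t rs) len) (trans (sumN-swapAt t rs) total)))


-1ℚ : ℚ
-1ℚ = ℚ.- 1ℚ

-1*-1*q≡q : ∀ q → -1ℚ ℚ.* (-1ℚ ℚ.* q) ≡ q
-1*-1*q≡q q = trans (sym (ℚP.*-assoc -1ℚ -1ℚ q)) (ℚP.*-identityˡ q)

signQ-suc : ∀ e → signQ (suc e) ≡ -1ℚ ℚ.* signQ e
signQ-suc zero          = refl
signQ-suc (suc zero)    = refl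
signQ-suc (suc (suc e)) = signQ-suc e

signQ-+ : ∀ x y → signQ (x ℕ.+ y) ≡ signQ x ℚ.* signQ y
signQ-+ zero    y = sym (ℚP.*-identityˡ (signQ y))
signQ-+ (suc x) y = begin
  signQ (suc (x ℕ.+ y))               ≡⟨ signQ-suc (x ℕ.+ y) ⟩
  -1ℚ ℚ.* signQ (x ℕ.+ y)             ≡⟨ cong (-1ℚ ℚ.*_) (signQ-+ x y) ⟩
  -1ℚ ℚ.* (signQ x ℚ.* signQ y)       ≡⟨ ℚP.*-assoc -1ℚ (signQ x) (signQ y) ⟨
  (-1ℚ ℚ.* signQ x) ℚ.* signQ y       ≡⟨ cong (ℚ._* signQ y) (signQ-suc x) ⟨
  signQ (suc x) ℚ.* signQ y           ∎
  where open ≡-Reasoning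

powQ : ℚ → ℕ → ℚ
powQ c zero    = 1ℚ
powQ c (suc k) = c ℚ.* powQ c k

powQ-1-odd : ∀ r → powQ -1ℚ (suc (2 ℕ.* r)) ≡ -1ℚ
powQ-1-odd zero    = refl
powQ-1-odd (suc r) =
  trans (cong (λ k → powQ -1ℚ (suc k)) (ℕP.*-suc 2 r)) (trans (-1*-1*q≡q (powQ -1ℚ (suc (2 ℕ.* r)))) (powQ-1-odd r))

-- Polynomials are compared up to reordering of their terms (_↭_), which preserves every coefficient.

Term : ℕ → Set
Term n = ℚ × Mono n

oneTerm : ∀ {n} → Term n
oneTerm {n} = 1ℚ , V.replicate n 0

mulTerm : ∀ {n} → Term n → Term n → Term n
mulTerm (a , e) (b , f) = a ℚ.* b , V.zipWith ℕ._+_ e f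

scaleTerm : ∀ {n} → ℚ → Term n → Term n
scaleTerm c (a , e) = c ℚ.* a , e

mulTerm-comm : ∀ {n} (s t : Term n) → mulTerm s t ≡ mulTerm t s
mulTerm-comm (a , e) (b , f) = cong₂ _,_ (ℚP.*-comm a b) (VP.zipWith-comm ℕP.+-comm e f)

mulTerm-assoc : ∀ {n} (s t u : Term n) → mulTerm (mulTerm s t) u ≡ mulTerm s (mulTerm t u)
mulTerm-assoc (a , e) (b , f) (c , g) = cong₂ _,_ (ℚP.*-assoc a b c) (VP.zipWith-assoc ℕP.+-assoc e f g)

mulTerm-scaleˡ : ∀ {n} c (s t : Term n) → mulTerm (scaleTerm c s) t ≡ scaleTerm c (mulTerm s t)
mulTerm-scaleˡ c (a , e) (b , f) = cong (_, _) (ℚP.*-assoc c a b)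

mulTerm-scaleʳ : ∀ {n} c (s t : Term n) → mulTerm s (scaleTerm c t) ≡ scaleTerm c (mulTerm s t)
mulTerm-scaleʳ c (a , e) (b , f) = cong (_, _) (*-left-comm a c b)

scaleTerm-scaleTerm : ∀ {n} c d (t : Term n) → scaleTerm c (scaleTerm d t) ≡ scaleTerm (c ℚ.* d) t
scaleTerm-scaleTerm c d (a , e) = cong (_, e) (sym (ℚP.*-assoc c d a))

module _ {n : ℕ} where

  ⊗-congˡ : {p p' : Poly n} (r : Poly n) → p ↭ p' → p ⊗ r ↭ p' ⊗ r
  ⊗-congˡ r = concatMap⁺ (λ t → L.map (mulTerm t) r)

  ⊗-congʳ : (p : Poly n) {r r' : Poly n} → r ↭ r' → p ⊗ r ↭ p ⊗ r'
  ⊗-congʳ p r↭r' = concatMap-cong-↭ p (All.universal (λ t → map⁺ (mulTerm t) r↭r') p)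

  ⊗-cong : {p p' r r' : Poly n} → p ↭ p' → r ↭ r' → p ⊗ r ↭ p' ⊗ r'
  ⊗-cong {p' = p'} {r} p↭p' r↭r' = ↭-trans (⊗-congˡ r p↭p') (⊗-congʳ p' r↭r')

  ⊗-zeroʳ : (p : Poly n) → p ⊗ [] ≡ []
  ⊗-zeroʳ []      = refl
  ⊗-zeroʳ (_ ∷ p) = ⊗-zeroʳ p

  ⊗-distribʳ-⊕ : (p q r : Poly n) → (p ⊕ q) ⊗ r ≡ (p ⊗ r) ⊕ (q ⊗ r)
  ⊗-distribʳ-⊕ []      q r = refl
  ⊗-distribʳ-⊕ (t ∷ p) q r =
    trans (cong (L.map (mulTerm t) r ++_) (⊗-distribʳ-⊕ p q r)) (sym (LP.++-assoc (L.map (mulTerm t) r) (p ⊗ r) (q ⊗ r)))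

  ⊗-consʳ : (q : Poly n) (t : Term n) (p : Poly n) → q ⊗ (t ∷ p) ↭ L.map (λ s → mulTerm s t) q ++ (q ⊗ p)
  ⊗-consʳ []      t p = ↭-refl
  ⊗-consʳ (s ∷ q) t p = prep (mulTerm s t) (↭-trans (++⁺ˡ (L.map (mulTerm s) p) (⊗-consʳ q t p))
                                                     (shifts (L.map (mulTerm s) p) (L.map (λ s' → mulTerm s' t) q)))

  ⊗-comm : (p q : Poly n) → p ⊗ q ↭ q ⊗ p
  ⊗-comm []      q = ↭-reflexive (sym (⊗-zeroʳ q))
  ⊗-comm (t ∷ p) q = ↭-trans (++⁺ (↭-reflexive (LP.map-cong (mulTerm-comm t) q)) (⊗-comm p q)) (↭-sym (⊗-consʳ q t p))

  map-mulTerm-⊗ : (t : Term n) (q r : Poly n) → L.map (mulTerm t) q ⊗ r ≡ L.map (mulTerm t) (q ⊗ r)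
  map-mulTerm-⊗ t []      r = refl
  map-mulTerm-⊗ t (s ∷ q) r =
    trans (cong₂ _++_ (trans (LP.map-cong (mulTerm-assoc t s) r) (LP.map-∘ r)) (map-mulTerm-⊗ t q r))
          (sym (LP.map-++ (mulTerm t) (L.map (mulTerm s) r) (q ⊗ r)))

  ⊗-assoc : (p q r : Poly n) → (p ⊗ q) ⊗ r ≡ p ⊗ (q ⊗ r)
  ⊗-assoc []      q r = refl
  ⊗-assoc (t ∷ p) q r = trans (⊗-distribʳ-⊕ (L.map (mulTerm t) q) (p ⊗ q) r)
                              (cong₂ _++_ (map-mulTerm-⊗ t q r) (⊗-assoc p q r))

  scale-⊕ : (c : ℚ) (p q : Poly n) → scale c (p ⊕ q) ≡ scale c p ⊕ scale c q
  scale-⊕ c = LP.map-++ (scaleTerm c)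

  scale-⊗ˡ : (c : ℚ) (p r : Poly n) → scale c p ⊗ r ≡ scale c (p ⊗ r)
  scale-⊗ˡ c []      r = refl
  scale-⊗ˡ c (t ∷ p) r =
    trans (cong₂ _++_ (trans (LP.map-cong (mulTerm-scaleˡ c t) r) (LP.map-∘ r)) (scale-⊗ˡ c p r))
          (sym (scale-⊕ c (L.map (mulTerm t) r) (p ⊗ r)))

  scale-⊗ʳ : (c : ℚ) (p r : Poly n) → p ⊗ scale c r ≡ scale c (p ⊗ r)
  scale-⊗ʳ c []      r = refl
  scale-⊗ʳ c (t ∷ p) r =
    trans (cong₂ _++_ (trans (sym (LP.map-∘ r)) (trans (LP.map-cong (mulTerm-scaleʳ c t) r) (LP.map-∘ r))) (scale-⊗ʳ c p r))
          (sym (scale-⊕ c (L.map (mulTerm t) r) (p ⊗ r)))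

  scale-scale : (c d : ℚ) (p : Poly n) → scale c (scale d p) ≡ scale (c ℚ.* d) p
  scale-scale c d p = trans (sym (LP.map-∘ p)) (LP.map-cong (scaleTerm-scaleTerm c d) p)

  scale-comm : (c d : ℚ) (p : Poly n) → scale c (scale d p) ≡ scale d (scale c p)
  scale-comm c d p = trans (scale-scale c d p) (trans (cong (λ x → scale x p) (ℚP.*-comm c d)) (sym (scale-scale d c p)))

  scale-identity : (p : Poly n) → scale 1ℚ p ≡ p
  scale-identity p = trans (LP.map-cong (λ { (q , e) → cong (_, e) (ℚP.*-identityˡ q) }) p) (LP.map-id p)

  scale-1-involutive : (p : Poly n) → scale -1ℚ (scale -1ℚ p) ≡ p
  scale-1-involutive p = trans (scale-scale -1ℚ -1ℚ p) (scale-identity p)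

  scale-sumP : (c : ℚ) (ps : List (Poly n)) → scale c (sumP ps) ≡ sumP (L.map (scale c) ps)
  scale-sumP c []       = refl
  scale-sumP c (p ∷ ps) = trans (scale-⊕ c p (sumP ps)) (cong (scale c p ++_) (scale-sumP c ps))

  scale-↭ : (c : ℚ) {p q : Poly n} → p ↭ q → scale c p ↭ scale c q
  scale-↭ c = map⁺ (scaleTerm c)

  powP-scale : (c : ℚ) (x : Poly n) (k : ℕ) → powP (scale c x) k ≡ scale (powQ c k) (powP x k)
  powP-scale c x zero    = refl
  powP-scale c x (suc k) = begin
    scale c x ⊗ powP (scale c x) k                ≡⟨ cong (scale c x ⊗_) (powP-scale c x k) ⟩
    scale c x ⊗ scale (powQ c k) (powP x k)        ≡⟨ scale-⊗ʳ (powQ c k) (scale c x) (powP x k) ⟩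
    scale (powQ c k) (scale c x ⊗ powP x k)        ≡⟨ cong (scale (powQ c k)) (scale-⊗ˡ c x (powP x k)) ⟩
    scale (powQ c k) (scale c (powP x (suc k)))    ≡⟨ scale-comm (powQ c k) c _ ⟩
    scale c (scale (powQ c k) (powP x (suc k)))    ≡⟨ scale-scale c (powQ c k) _ ⟩
    scale (c ℚ.* powQ c k) (powP x (suc k))        ∎
    where open ≡-Reasoning

  powP-↭ : {x y : Poly n} (k : ℕ) → x ↭ y → powP x k ↭ powP y k
  powP-↭ zero    _   = ↭-refl
  powP-↭ (suc k) x↭y = ⊗-cong x↭y (powP-↭ k x↭y)

-- The polynomial T_d

if-rel : {A B : Set} (R : A → B → Set) (c : Bool) {x y : A} {x' y' : B} →
         R x x' → R y y' → R (if c then x else y) (if c then x' else y')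
if-rel R true  r _ = r
if-rel R false _ r = r

module _ {n : ℕ} where

  oddPowerTerm : ℕ → Poly n → Poly n
  oddPowerTerm r x = scale (inv (suc (2 ℕ.* r))) (powP x (suc (2 ℕ.* r)))

  Tmonomial : ℕ → List ℕ → List (Poly n) → Poly n
  Tmonomial m rs xs = scale (multinom m rs) (prodP (zipWith oddPowerTerm rs xs))

  Tsum : ℕ → ℕ → List (Poly n) → Poly n
  Tsum m k xs = sumP (L.map (λ rs → Tmonomial m rs xs) (comps m k))

  -- Tpoly d xs unfolds to Tform d (length xs) xs; keeping k apart lets xs be replaced by a list of the same length.
  Tform : ℕ → ℕ → List (Poly n) → Poly n
  Tform d k xs = if d <ᵇ k then zeroP
                 else if (d % 2) ≡ᵇ 1 then zeroP
                 else scale (cHalf ((d ∸ k) ℕ./ 2)) (Tsum ((d ∸ k) ℕ./ 2) k xs)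

  Tform-rel : (R : Poly n → Poly n → Set) → R zeroP zeroP → ∀ d k {xs ys} →
              (∀ m → R (scale (cHalf m) (Tsum m k xs)) (scale (cHalf m) (Tsum m k ys))) →
              R (Tform d k xs) (Tform d k ys)
  Tform-rel R R0 d k RT = if-rel R (d <ᵇ k) R0 (if-rel R ((d % 2) ≡ᵇ 1) R0 (RT ((d ∸ k) ℕ./ 2)))

  Tform-scale : ∀ d k c {xs ys : List (Poly n)} → (∀ m → Tsum m k xs ≡ scale c (Tsum m k ys)) →
                Tform d k xs ≡ scale c (Tform d k ys)
  Tform-scale d k c {ys = ys} eq = Tform-rel (λ X Y → X ≡ scale c Y) refl d k λ m →
    trans (cong (scale (cHalf m)) (eq m)) (scale-comm (cHalf m) c (Tsum m k ys))

  oddPowerTerm-↭ : ∀ r {x y : Poly n} → x ↭ y → oddPowerTerm r x ↭ oddPowerTerm r y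
  oddPowerTerm-↭ r x↭y = scale-↭ (inv (suc (2 ℕ.* r))) (powP-↭ (suc (2 ℕ.* r)) x↭y)

  prodP-oddPowers-cong : ∀ rs {xs ys : List (Poly n)} → Pointwise _↭_ xs ys →
                         prodP (zipWith oddPowerTerm rs xs) ↭ prodP (zipWith oddPowerTerm rs ys)
  prodP-oddPowers-cong []       _              = ↭-refl
  prodP-oddPowers-cong (r ∷ rs) []             = ↭-refl
  prodP-oddPowers-cong (r ∷ rs) (x↭y ∷ xs↭ys) = ⊗-cong (oddPowerTerm-↭ r x↭y) (prodP-oddPowers-cong rs xs↭ys)

  Tpoly-cong : ∀ d {xs ys : List (Poly n)} → Pointwise _↭_ xs ys → Tpoly d xs ↭ Tpoly d ys
  Tpoly-cong d {xs} {ys} xs↭ys rewrite Pointwise.Pointwise-length xs↭ys =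
    Tform-rel _↭_ ↭-refl d (length ys) λ m → scale-↭ (cHalf m) (concatMap-cong-↭ (comps m (length ys))
      (All.universal (λ rs → scale-↭ (multinom m rs) (prodP-oddPowers-cong rs xs↭ys)) _))

  prodQ-swapAt : ∀ t (qs : List ℚ) → prodQ (swapAt t qs) ≡ prodQ qs
  prodQ-swapAt zero    []           = refl
  prodQ-swapAt zero    (a ∷ [])     = refl
  prodQ-swapAt zero    (a ∷ b ∷ qs) = *-left-comm b a (prodQ qs)
  prodQ-swapAt (suc t) []           = refl
  prodQ-swapAt (suc t) (a ∷ qs)     = cong (a ℚ.*_) (prodQ-swapAt t qs)

  multinom-swapAt : ∀ m t rs → multinom m (swapAt t rs) ≡ multinom m rs
  multinom-swapAt m t rs = cong (ℕtoℚ (m ℕ.!) ℚ.*_)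
    (trans (cong prodQ (map-swapAt (λ r → inv (r ℕ.!)) t rs)) (prodQ-swapAt t (L.map (λ r → inv (r ℕ.!)) rs)))

  prodP-swapAt : ∀ t (ys : List (Poly n)) → prodP (swapAt t ys) ↭ prodP ys
  prodP-swapAt zero    []           = ↭-refl
  prodP-swapAt zero    (a ∷ [])     = ↭-refl
  prodP-swapAt zero    (a ∷ b ∷ ys) = ↭-trans (↭-reflexive (sym (⊗-assoc b a (prodP ys))))
    (↭-trans (⊗-congˡ (prodP ys) (⊗-comm b a)) (↭-reflexive (⊗-assoc a b (prodP ys))))
  prodP-swapAt (suc t) []           = ↭-refl
  prodP-swapAt (suc t) (a ∷ ys)     = ⊗-congʳ a (prodP-swapAt t ys)

  Tmonomial-swapAt : ∀ m t rs (xs : List (Poly n)) → length rs ≡ length xs →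
                     Tmonomial m (swapAt t rs) (swapAt t xs) ↭ Tmonomial m rs xs
  Tmonomial-swapAt m t rs xs eq rewrite multinom-swapAt m t rs | zipWith-swapAt oddPowerTerm t rs xs eq =
    scale-↭ (multinom m rs) (prodP-swapAt t (zipWith oddPowerTerm rs xs))

  -- The sum over compositions is reindexed by the same transposition.
  Tsum-swapAt : ∀ m t (xs : List (Poly n)) → Tsum m (length xs) (swapAt t xs) ↭ Tsum m (length xs) xs
  Tsum-swapAt m t xs = ↭-trans
    (concat⁺ (map⁺ (λ rs → Tmonomial m rs (swapAt t xs)) (↭-sym (swapAt-comps t m (length xs)))))
    (↭-trans (↭-reflexive (cong sumP (sym (LP.map-∘ (comps m (length xs))))))
      (concatMap-cong-↭ (comps m (length xs))
        (All.tabulate λ rs∈ → Tmonomial-swapAt m t _ xs (proj₁ (∈-comps⁻ m _ rs∈)))))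

  Tpoly-swapAt : ∀ d t (xs : List (Poly n)) → Tpoly d (swapAt t xs) ↭ Tpoly d xs
  Tpoly-swapAt d t xs rewrite length-swapAt t xs = Tform-rel _↭_ ↭-refl d (length xs) λ m →
    scale-↭ (cHalf m) (Tsum-swapAt m t xs)

  -- The prefix P locates each swap of the permutation proof, which is then swapAt (length P).
  Tpoly-↭-++ : ∀ d (P : List (Poly n)) {ys ys'} → ys ↭ ys' → Tpoly d (P ++ ys) ↭ Tpoly d (P ++ ys')
  Tpoly-↭-++ d P _↭_.refl = ↭-refl
  Tpoly-↭-++ d P {x ∷ ys} {.x ∷ ys'} (prep x p) =
    subst₂ (λ u v → Tpoly d u ↭ Tpoly d v) (LP.++-assoc P [ x ] ys) (LP.++-assoc P [ x ] ys')
      (Tpoly-↭-++ d (P ++ [ x ]) p)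
  Tpoly-↭-++ d P {x ∷ y ∷ ys} {.y ∷ .x ∷ ys'} (swap x y p) = ↭-trans
    (subst (λ u → Tpoly d u ↭ Tpoly d (P ++ y ∷ x ∷ ys)) (swapAt-length-++ P y x ys)
      (Tpoly-swapAt d (length P) (P ++ y ∷ x ∷ ys)))
    (subst₂ (λ u v → Tpoly d u ↭ Tpoly d v)
      (trans (LP.++-assoc (P ++ [ y ]) [ x ] ys) (LP.++-assoc P [ y ] (x ∷ ys)))
      (trans (LP.++-assoc (P ++ [ y ]) [ x ] ys') (LP.++-assoc P [ y ] (x ∷ ys')))
      (Tpoly-↭-++ d ((P ++ [ y ]) ++ [ x ]) p))
  Tpoly-↭-++ d P (_↭_.trans p q) = ↭-trans (Tpoly-↭-++ d P p) (Tpoly-↭-++ d P q)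

  Tpoly-↭ : ∀ d {xs ys : List (Poly n)} → xs ↭ ys → Tpoly d xs ↭ Tpoly d ys
  Tpoly-↭ d = Tpoly-↭-++ d []

  oddPowerTerm-negate : ∀ r (x : Poly n) → oddPowerTerm r (scale -1ℚ x) ≡ scale -1ℚ (oddPowerTerm r x)
  oddPowerTerm-negate r x = begin
    scale c (powP (scale -1ℚ x) (suc (2 ℕ.* r)))           ≡⟨ cong (scale c) (powP-scale -1ℚ x (suc (2 ℕ.* r))) ⟩
    scale c (scale (powQ -1ℚ (suc (2 ℕ.* r))) x^)          ≡⟨ cong (λ q → scale c (scale q x^)) (powQ-1-odd r) ⟩
    scale c (scale -1ℚ x^)                                 ≡⟨ scale-comm c -1ℚ x^ ⟩
    scale -1ℚ (scale c x^)                                 ∎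
    where
    open ≡-Reasoning
    c  = inv (suc (2 ℕ.* r))
    x^ = powP x (suc (2 ℕ.* r))

  Tmonomial-negate-head : ∀ m r rs (x : Poly n) xs →
                          Tmonomial m (r ∷ rs) (scale -1ℚ x ∷ xs) ≡ scale -1ℚ (Tmonomial m (r ∷ rs) (x ∷ xs))
  Tmonomial-negate-head m r rs x xs = begin
    scale c (oddPowerTerm r (scale -1ℚ x) ⊗ R)      ≡⟨ cong (λ y → scale c (y ⊗ R)) (oddPowerTerm-negate r x) ⟩
    scale c (scale -1ℚ (oddPowerTerm r x) ⊗ R)      ≡⟨ cong (scale c) (scale-⊗ˡ -1ℚ (oddPowerTerm r x) R) ⟩
    scale c (scale -1ℚ (oddPowerTerm r x ⊗ R))      ≡⟨ scale-comm c -1ℚ _ ⟩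
    scale -1ℚ (scale c (oddPowerTerm r x ⊗ R))      ∎
    where
    open ≡-Reasoning
    c = multinom m (r ∷ rs)
    R = prodP (zipWith oddPowerTerm rs xs)

  Tsum-negate-head : ∀ m (x : Poly n) xs →
                     Tsum m (suc (length xs)) (scale -1ℚ x ∷ xs) ≡ scale -1ℚ (Tsum m (suc (length xs)) (x ∷ xs))
  Tsum-negate-head m x xs = trans
    (cong sumP (LP.map-cong-local {f = λ rs → Tmonomial m rs (scale -1ℚ x ∷ xs)} (All.tabulate negate)))
    (trans (cong sumP (LP.map-∘ rss)) (sym (scale-sumP -1ℚ (L.map (λ rs → Tmonomial m rs (x ∷ xs)) rss))))
    where
    rss = comps m (suc (length xs))
    negate : ∀ {rs} → rs ∈ rss →
             Tmonomial m rs (scale -1ℚ x ∷ xs) ≡ scale -1ℚ (Tmonomial m rs (x ∷ xs))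
    negate {[]}     rs∈ = ⊥-elim (ℕP.0≢1+n (proj₁ (∈-comps⁻ m (suc (length xs)) rs∈)))
    negate {r ∷ rs} _   = Tmonomial-negate-head m r rs x xs

  Tpoly-negate-head : ∀ d (x : Poly n) xs → Tpoly d (scale -1ℚ x ∷ xs) ≡ scale -1ℚ (Tpoly d (x ∷ xs))
  Tpoly-negate-head d x xs = Tform-scale d (suc (length xs)) -1ℚ (λ m → Tsum-negate-head m x xs)

  Tpoly-swap-head : ∀ d (x y : Poly n) zs → Tpoly d (y ∷ x ∷ zs) ↭ Tpoly d (x ∷ y ∷ zs)
  Tpoly-swap-head d x y zs = Tpoly-↭ d {y ∷ x ∷ zs} (swap y x ↭-refl)

  Tpoly-negate-second : ∀ d (x y : Poly n) zs → Tpoly d (x ∷ scale -1ℚ y ∷ zs) ↭ scale -1ℚ (Tpoly d (x ∷ y ∷ zs))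
  Tpoly-negate-second d x y zs = ↭-trans (Tpoly-swap-head d (scale -1ℚ y) x zs)
    (↭-trans (↭-reflexive (Tpoly-negate-head d y (x ∷ zs))) (scale-↭ -1ℚ (Tpoly-swap-head d x y zs)))

  Tpoly-negate-swap-head : ∀ d (x y : Poly n) zs → Tpoly d (scale -1ℚ y ∷ scale -1ℚ x ∷ zs) ↭ Tpoly d (x ∷ y ∷ zs)
  Tpoly-negate-swap-head d x y zs = begin
    Tpoly d (scale -1ℚ y ∷ scale -1ℚ x ∷ zs)       ≡⟨ Tpoly-negate-head d y (scale -1ℚ x ∷ zs) ⟩
    scale -1ℚ (Tpoly d (y ∷ scale -1ℚ x ∷ zs))     ↭⟨ scale-↭ -1ℚ (Tpoly-negate-second d y x zs) ⟩
    scale -1ℚ (scale -1ℚ (Tpoly d (y ∷ x ∷ zs)))   ≡⟨ scale-1-involutive (Tpoly d (y ∷ x ∷ zs)) ⟩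
    Tpoly d (y ∷ x ∷ zs)                           ↭⟨ Tpoly-swap-head d x y zs ⟩
    Tpoly d (x ∷ y ∷ zs)                           ∎
    where open PermutationReasoning

matchingTerm : ∀ {n} → ℕ → Vec (Fin n) n → Poly n
matchingTerm d σ = scale (matchingSign σ) (Tpoly d (forms σ))

module MultiplicativeMap {n : ℕ} (f : Term n → Term n)
  (f-mul   : ∀ s t → f (mulTerm s t) ≡ mulTerm (f s) (f t))
  (f-one   : f oneTerm ≡ oneTerm)
  (f-scale : ∀ c t → f (scaleTerm c t) ≡ scaleTerm c (f t)) where

  mapP : Poly n → Poly n
  mapP = L.map f

  mapP-⊕ : ∀ p q → mapP (p ⊕ q) ≡ mapP p ⊕ mapP q
  mapP-⊕ = LP.map-++ f

  mapP-⊗ : ∀ p q → mapP (p ⊗ q) ≡ mapP p ⊗ mapP q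
  mapP-⊗ []      q = refl
  mapP-⊗ (t ∷ p) q = trans (mapP-⊕ (L.map (mulTerm t) q) (p ⊗ q))
    (cong₂ _++_ (trans (sym (LP.map-∘ q)) (trans (LP.map-cong (f-mul t) q) (LP.map-∘ q))) (mapP-⊗ p q))

  mapP-scale : ∀ c p → mapP (scale c p) ≡ scale c (mapP p)
  mapP-scale c p = trans (sym (LP.map-∘ p)) (trans (LP.map-cong (f-scale c) p) (LP.map-∘ p))

  mapP-powP : ∀ x k → mapP (powP x k) ≡ powP (mapP x) k
  mapP-powP x zero    = cong [_] f-one
  mapP-powP x (suc k) = trans (mapP-⊗ x (powP x k)) (cong (mapP x ⊗_) (mapP-powP x k))

  mapP-oddPowerTerm : ∀ r x → mapP (oddPowerTerm r x) ≡ oddPowerTerm r (mapP x)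
  mapP-oddPowerTerm r x = trans (mapP-scale c (powP x (suc (2 ℕ.* r)))) (cong (scale c) (mapP-powP x (suc (2 ℕ.* r))))
    where c = inv (suc (2 ℕ.* r))

  mapP-oddPowers : ∀ rs xs → mapP (prodP (zipWith oddPowerTerm rs xs)) ≡ prodP (zipWith oddPowerTerm rs (L.map mapP xs))
  mapP-oddPowers []       xs       = cong [_] f-one
  mapP-oddPowers (r ∷ rs) []       = cong [_] f-one
  mapP-oddPowers (r ∷ rs) (x ∷ xs) = trans (mapP-⊗ (oddPowerTerm r x) (prodP (zipWith oddPowerTerm rs xs)))
    (cong₂ _⊗_ (mapP-oddPowerTerm r x) (mapP-oddPowers rs xs))

  mapP-sumP : ∀ ps → mapP (sumP ps) ≡ sumP (L.map mapP ps)
  mapP-sumP []       = refl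
  mapP-sumP (p ∷ ps) = trans (mapP-⊕ p (sumP ps)) (cong (mapP p ++_) (mapP-sumP ps))

  mapP-Tsum : ∀ m k xs → mapP (Tsum m k xs) ≡ Tsum m k (L.map mapP xs)
  mapP-Tsum m k xs = trans (mapP-sumP (L.map (λ rs → Tmonomial m rs xs) (comps m k)))
    (cong sumP (trans (sym (LP.map-∘ (comps m k))) (LP.map-cong mapP-Tmonomial (comps m k))))
    where
    mapP-Tmonomial : ∀ rs → mapP (Tmonomial m rs xs) ≡ Tmonomial m rs (L.map mapP xs)
    mapP-Tmonomial rs = trans (mapP-scale (multinom m rs) (prodP (zipWith oddPowerTerm rs xs)))
                              (cong (scale (multinom m rs)) (mapP-oddPowers rs xs))

  mapP-Tpoly : ∀ d xs → mapP (Tpoly d xs) ≡ Tpoly d (L.map mapP xs)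
  mapP-Tpoly d xs rewrite sym (LP.length-map mapP xs) = Tform-rel (λ X Y → mapP X ≡ Y) refl d (length (L.map mapP xs))
    λ m → trans (mapP-scale (cHalf m) (Tsum m (length (L.map mapP xs)) xs))
                (cong (scale (cHalf m)) (mapP-Tsum m (length (L.map mapP xs)) xs))

  mapP-matchingTerm : ∀ d σ → mapP (matchingTerm d σ) ≡ scale (matchingSign σ) (Tpoly d (L.map mapP (forms σ)))
  mapP-matchingTerm d σ =
    trans (mapP-scale (matchingSign σ) (Tpoly d (forms σ))) (cong (scale (matchingSign σ)) (mapP-Tpoly d (forms σ)))

  mapP-Z : ∀ d → mapP (Z n d) ≡ scale (inv (2 ℕ.^ (d ℕ./ 2))) (sumP (L.map (mapP ∘ matchingTerm d) (maxMatchings n)))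
  mapP-Z d = trans (mapP-scale c (sumP (L.map (matchingTerm d) (maxMatchings n))))
    (cong (scale c) (trans (mapP-sumP (L.map (matchingTerm d) (maxMatchings n))) (cong sumP (sym (LP.map-∘ (maxMatchings n))))))
    where c = inv (2 ℕ.^ (d ℕ./ 2))

module _ {n : ℕ} where

  unit : Fin n → Mono n
  unit j = V.tabulate (λ l → if does (j F.≟ l) then 1 else 0)

  lookup-unit : ∀ j l → V.lookup (unit j) l ≡ (if does (j F.≟ l) then 1 else 0)
  lookup-unit j l = VP.lookup∘tabulate _ l

  reflectTerm : Fin n → Term n → Term n
  reflectTerm i (q , e) = signQ (V.lookup e i) ℚ.* q , e

  reflectTerm-mul : ∀ i (s t : Term n) → reflectTerm i (mulTerm s t) ≡ mulTerm (reflectTerm i s) (reflectTerm i t)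
  reflectTerm-mul i (a , e) (b , f) = cong (_, _) (trans
    (cong (ℚ._* (a ℚ.* b)) (trans (cong signQ (VP.lookup-zipWith ℕ._+_ i e f)) (signQ-+ (V.lookup e i) (V.lookup f i))))
    (*-interchange (signQ (V.lookup e i)) (signQ (V.lookup f i)) a b))

  reflectTerm-one : ∀ i → reflectTerm i oneTerm ≡ oneTerm
  reflectTerm-one i rewrite VP.lookup-replicate i 0 = refl

  reflectTerm-scale : ∀ i c (t : Term n) → reflectTerm i (scaleTerm c t) ≡ scaleTerm c (reflectTerm i t)
  reflectTerm-scale i c (a , e) = cong (_, e) (*-left-comm (signQ (V.lookup e i)) c a)

  module Reflection (i : Fin n) = MultiplicativeMap (reflectTerm i) (reflectTerm-mul i) (reflectTerm-one i) (reflectTerm-scale i)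

  reflect-var-≢ : ∀ {i j} → j ≢ i → reflect i (var j) ≡ var j
  reflect-var-≢ {i} {j} j≢i rewrite lookup-unit j i | dec-false (j F.≟ i) j≢i = refl

  reflect-var-≡ : ∀ i → reflect i (var i) ≡ scale -1ℚ (var i)
  reflect-var-≡ i rewrite lookup-unit i i | dec-true (i F.≟ i) refl = refl

  permuteMono : (Fin n → Fin n) → Mono n → Mono n
  permuteMono π e = V.tabulate (λ j → V.lookup e (π j))

  lookup-permuteMono : ∀ π e j → V.lookup (permuteMono π e) j ≡ V.lookup e (π j)
  lookup-permuteMono π e j = VP.lookup∘tabulate _ j

  Vec-ext : {A : Set} {u v : Vec A n} → (∀ l → V.lookup u l ≡ V.lookup v l) → u ≡ v
  Vec-ext {u = u} {v} eq = trans (sym (VP.tabulate∘lookup u)) (trans (VP.tabulate-cong eq) (VP.tabulate∘lookup v))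

  permuteTerm : (Fin n → Fin n) → Term n → Term n
  permuteTerm π (q , e) = q , permuteMono π e

  permuteTerm-mul : ∀ π (s t : Term n) → permuteTerm π (mulTerm s t) ≡ mulTerm (permuteTerm π s) (permuteTerm π t)
  permuteTerm-mul π (a , e) (b , f) = cong (_ ,_) (Vec-ext λ l → begin
    V.lookup (permuteMono π (V.zipWith ℕ._+_ e f)) l         ≡⟨ lookup-permuteMono π (V.zipWith ℕ._+_ e f) l ⟩
    V.lookup (V.zipWith ℕ._+_ e f) (π l)                     ≡⟨ VP.lookup-zipWith ℕ._+_ (π l) e f ⟩
    V.lookup e (π l) ℕ.+ V.lookup f (π l)                    ≡⟨ cong₂ ℕ._+_ (lookup-permuteMono π e l) (lookup-permuteMono π f l) ⟨
    V.lookup (permuteMono π e) l ℕ.+ V.lookup (permuteMono π f) l ≡⟨ VP.lookup-zipWith ℕ._+_ l (permuteMono π e) (permuteMono π f) ⟨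
    V.lookup (V.zipWith ℕ._+_ (permuteMono π e) (permuteMono π f)) l ∎)
    where open ≡-Reasoning

  permuteTerm-one : ∀ π → permuteTerm π oneTerm ≡ oneTerm
  permuteTerm-one π = cong (1ℚ ,_) (Vec-ext λ l →
    trans (lookup-permuteMono π (V.replicate n 0) l) (trans (VP.lookup-replicate (π l) 0) (sym (VP.lookup-replicate l 0))))

  permuteTerm-scale : ∀ π c (t : Term n) → permuteTerm π (scaleTerm c t) ≡ scaleTerm c (permuteTerm π t)
  permuteTerm-scale π c t = refl

  module Renaming (π : Fin n → Fin n) = MultiplicativeMap (permuteTerm π) (permuteTerm-mul π) (permuteTerm-one π) (permuteTerm-scale π)

  module _ {π : Fin n → Fin n} (π-involutive : ∀ x → π (π x) ≡ x) where

    permuteMono-involutive : ∀ e → permuteMono π (permuteMono π e) ≡ e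
    permuteMono-involutive e = Vec-ext λ l →
      trans (lookup-permuteMono π (permuteMono π e) l) (trans (lookup-permuteMono π e (π l)) (cong (V.lookup e) (π-involutive l)))

    Renaming-var : ∀ j → Renaming.mapP π (var j) ≡ var (π j)
    Renaming-var j = cong (λ e → (1ℚ , e) ∷ []) (Vec-ext λ l →
      trans (lookup-permuteMono π (unit j) l) (trans (lookup-unit j (π l))
        (trans (unit-entry (j F.≟ π l) (π j F.≟ l)) (sym (lookup-unit (π j) l)))))
      where
      unit-entry : ∀ {l} (p : Dec (j ≡ π l)) (q : Dec (π j ≡ l)) → (if does p then 1 else 0) ≡ (if does q then 1 else 0)
      unit-entry     (yes _)   (yes _)   = refl
      unit-entry     (no _)    (no _)    = refl
      unit-entry {l} (yes j≡)  (no π≢)   = ⊥-elim (π≢ (trans (cong π j≡) (π-involutive l)))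
      unit-entry     (no j≢)   (yes π≡)  = ⊥-elim (j≢ (trans (sym (π-involutive j)) (cong π π≡)))

sumQ-↭ : {xs ys : List ℚ} → xs ↭ ys → sumQ xs ≡ sumQ ys
sumQ-↭ _↭_.refl                                = refl
sumQ-↭ (prep x p)                              = cong (x ℚ.+_) (sumQ-↭ p)
sumQ-↭ {x ∷ y ∷ xs} {.y ∷ .x ∷ ys} (swap x y p) = trans (+-left-comm x y (sumQ xs)) (cong (λ s → y ℚ.+ (x ℚ.+ s)) (sumQ-↭ p))
  where open CommSemigroupProperties (CommutativeMonoid.commutativeSemigroup ℚP.+-0-commutativeMonoid)
          renaming (x∙yz≈y∙xz to +-left-comm)
sumQ-↭ (_↭_.trans p q)                         = trans (sumQ-↭ p) (sumQ-↭ q)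

sumQ-zero : (xs : List ℚ) → All (_≡ 0ℚ) xs → sumQ xs ≡ 0ℚ
sumQ-zero []       []             = refl
sumQ-zero (x ∷ xs) (refl ∷ zeros) = trans (ℚP.+-identityˡ (sumQ xs)) (sumQ-zero xs zeros)

sumQ-scale : (c : ℚ) (xs : List ℚ) → sumQ (L.map (c ℚ.*_) xs) ≡ c ℚ.* sumQ xs
sumQ-scale c []       = sym (ℚP.*-zeroʳ c)
sumQ-scale c (x ∷ xs) = trans (cong (c ℚ.* x ℚ.+_) (sumQ-scale c xs)) (sym (ℚP.*-distribˡ-+ c x (sumQ xs)))

module _ {n : ℕ} where

  coeffTerm : Mono n → Term n → ℚ
  coeffTerm e (q , f) = if does (VP.≡-dec ℕ._≟_ e f) then q else 0ℚ

  coeff-↭ : ∀ {p q : Poly n} e → p ↭ q → coeff p e ≡ coeff q e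
  coeff-↭ e p↭q = sumQ-↭ (map⁺ (coeffTerm e) p↭q)

  coeff-scale : ∀ c (p : Poly n) e → coeff (scale c p) e ≡ c ℚ.* coeff p e
  coeff-scale c p e = trans (cong sumQ (trans (sym (LP.map-∘ p)) (trans (LP.map-cong coeffTerm-scale p) (LP.map-∘ p))))
                            (sumQ-scale c (L.map (coeffTerm e) p))
    where
    coeffTerm-scale : ∀ t → coeffTerm e (scaleTerm c t) ≡ c ℚ.* coeffTerm e t
    coeffTerm-scale (q , f) with does (VP.≡-dec ℕ._≟_ e f)
    ... | true  = refl
    ... | false = sym (ℚP.*-zeroʳ c)

  coeff-vanishes : ∀ (p : Poly n) e → All (λ t → e ≢ proj₂ t) p → coeff p e ≡ 0ℚ
  coeff-vanishes p e e∉p = sumQ-zero (L.map (coeffTerm e) p) (AllP.map⁺ (All.map coeffTerm-≢ e∉p))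
    where
    coeffTerm-≢ : ∀ {t} → e ≢ proj₂ t → coeffTerm e t ≡ 0ℚ
    coeffTerm-≢ {q , f} e≢f rewrite dec-false (VP.≡-dec ℕ._≟_ e f) e≢f = refl

  coeff-renaming : ∀ {π : Fin n → Fin n} (π-involutive : ∀ x → π (π x) ≡ x) (p : Poly n) e →
                   coeff (Renaming.mapP π p) e ≡ coeff p (permuteMono π e)
  coeff-renaming {π} π-involutive p e = cong sumQ (trans (sym (LP.map-∘ p)) (LP.map-cong coeffTerm-permute p))
    where
    coeffTerm-permute : ∀ t → coeffTerm e (permuteTerm π t) ≡ coeffTerm (permuteMono π e) t
    coeffTerm-permute (q , f) with VP.≡-dec ℕ._≟_ e (permuteMono π f) | VP.≡-dec ℕ._≟_ (permuteMono π e) f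
    ... | yes _    | yes _    = refl
    ... | no _     | no _     = refl
    ... | yes e≡   | no πe≢  = ⊥-elim (πe≢ (trans (cong (permuteMono π) e≡) (permuteMono-involutive π-involutive f)))
    ... | no e≢    | yes πe≡ = ⊥-elim (e≢ (trans (sym (permuteMono-involutive π-involutive e)) (cong (permuteMono π) πe≡)))

-- Maximal matchings

∈-filterᵇ⁻ : ∀ {A : Set} (p : A → Bool) {xs : List A} {x} → x ∈ filterᵇ p xs → x ∈ xs × T (p x)
∈-filterᵇ⁻ p {xs} = ∈-filter⁻ (λ x → T? (p x)) {xs = xs}

∈-filterᵇ⁺ : ∀ {A : Set} (p : A → Bool) {xs : List A} {x} → x ∈ xs → T (p x) → x ∈ filterᵇ p xs
∈-filterᵇ⁺ p = ∈-filter⁺ (λ x → T? (p x))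

length≡1⇒singleton : ∀ {A : Set} (xs : List A) → length xs ≡ 1 → ∃ λ x → xs ≡ x ∷ []
length≡1⇒singleton (x ∷ []) _ = x , refl

T-does⁻ : ∀ {P : Set} (d : Dec P) → T (does d) → P
T-does⁻ (yes p) _ = p

T-does⁺ : ∀ {P : Set} (d : Dec P) → P → T (does d)
T-does⁺ (yes _) _ = tt
T-does⁺ (no ¬p) p = ¬p p

T-allB⁻ : ∀ {A : Set} (p : A → Bool) {xs : List A} → T (allB p xs) → ∀ {x} → x ∈ xs → T (p x)
T-allB⁻ p {_ ∷ xs} h (here refl) = proj₁ (Equivalence.to T-∧ h)
T-allB⁻ p {_ ∷ xs} h (there x∈)  = T-allB⁻ p (proj₂ (Equivalence.to T-∧ h)) x∈

T-allB⁺ : ∀ {A : Set} (p : A → Bool) (xs : List A) → (∀ {x} → x ∈ xs → T (p x)) → T (allB p xs)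
T-allB⁺ p []       h = tt
T-allB⁺ p (x ∷ xs) h = Equivalence.from T-∧ (h (here refl) , T-allB⁺ p xs (h ∘ there))

module _ {n : ℕ} where

  isLeftEnd : Vec (Fin n) n → Fin n → Bool
  isLeftEnd σ i = toℕ i <ᵇ toℕ (app σ i)

  ∈-leftEnds⁻ : ∀ σ {l} → l ∈ leftEnds σ → toℕ l < toℕ (app σ l)
  ∈-leftEnds⁻ σ l∈ = ℕP.<ᵇ⇒< _ _ (proj₂ (∈-filterᵇ⁻ (isLeftEnd σ) {xs = allFin n} l∈))

  ∈-leftEnds⁺ : ∀ σ {l} → toℕ l < toℕ (app σ l) → l ∈ leftEnds σ
  ∈-leftEnds⁺ σ {l} l< = ∈-filterᵇ⁺ (isLeftEnd σ) (∈-allFin l) (ℕP.<⇒<ᵇ l<)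

  leftEnds-unique : ∀ σ → Unique (leftEnds σ)
  leftEnds-unique σ = UniqueP.filter⁺ (λ i → T? (isLeftEnd σ i)) (UniqueP.allFin⁺ n)

  record IsMaxMatching (σ : Vec (Fin n) n) : Set where
    field
      involutive   : ∀ i → app σ (app σ i) ≡ i
      fixed        : Fin n
      fixedPoints≡ : fixedPoints σ ≡ fixed ∷ []

    fixed-fixed : app σ fixed ≡ fixed
    fixed-fixed = proj₂ (∈-filter⁻ (λ i → app σ i F.≟ i) {xs = allFin n} (subst (fixed ∈_) (sym fixedPoints≡) (here refl)))

    fixed-unique : ∀ {x} → app σ x ≡ x → x ≡ fixed
    fixed-unique {x} σx≡x with subst (x ∈_) fixedPoints≡ (∈-filter⁺ (λ i → app σ i F.≟ i) (∈-allFin x) σx≡x)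
    ... | here x≡ = x≡

    partner-≡ : ∀ {x y} → app σ x ≡ y → x ≡ app σ y
    partner-≡ {x} σx≡y = trans (sym (involutive x)) (cong (app σ) σx≡y)

    injective : ∀ {x y} → app σ x ≡ app σ y → x ≡ y
    injective {y = y} σx≡σy = trans (partner-≡ σx≡σy) (involutive y)

    leftEnd≢fixed : ∀ {l} → l ∈ leftEnds σ → l ≢ fixed
    leftEnd≢fixed l∈ refl = ℕP.<-irrefl (cong toℕ (sym fixed-fixed)) (∈-leftEnds⁻ σ l∈)

    partner≢fixed : ∀ {l} → l ∈ leftEnds σ → app σ l ≢ fixed
    partner≢fixed l∈ σl≡ = leftEnd≢fixed l∈ (trans (partner-≡ σl≡) fixed-fixed)

    partner∉leftEnds : ∀ {l} → l ∈ leftEnds σ → app σ l ∉ leftEnds σ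
    partner∉leftEnds {l} l∈ σl∈ =
      ℕP.<-asym (∈-leftEnds⁻ σ l∈) (subst (λ z → toℕ (app σ l) < toℕ z) (involutive l) (∈-leftEnds⁻ σ σl∈))

    edges-disjoint : ∀ {l l' x} → l ∈ leftEnds σ → l' ∈ leftEnds σ → l' ≢ l → x ≡ l ⊎ x ≡ app σ l →
                     l' ≢ x × app σ l' ≢ x
    edges-disjoint l∈ l'∈ l'≢l (inj₁ refl) = l'≢l , λ σl'≡l → partner∉leftEnds l'∈ (subst (_∈ leftEnds σ) (sym σl'≡l) l∈)
    edges-disjoint l∈ l'∈ l'≢l (inj₂ refl) = (λ { refl → partner∉leftEnds l∈ l'∈ }) , λ σl'≡σl → l'≢l (injective σl'≡σl)

    edge-leftEnd : ∀ {i} → app σ i ≢ i → ∃ λ l → l ∈ leftEnds σ × (i ≡ l ⊎ i ≡ app σ l)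
    edge-leftEnd {i} σi≢i with ℕP.<-cmp (toℕ i) (toℕ (app σ i))
    ... | tri< i< _ _ = i , ∈-leftEnds⁺ σ i< , inj₁ refl
    ... | tri≈ _ i≡ _ = ⊥-elim (σi≢i (sym (FP.toℕ-injective i≡)))
    ... | tri> _ _ σi< = app σ i , ∈-leftEnds⁺ σ (subst (λ z → toℕ (app σ i) < toℕ z) (sym (involutive i)) σi<) ,
                         inj₂ (sym (involutive i))

  T-isMaxMatching⁻ : ∀ {σ} → T (isMaxMatching σ) → IsMaxMatching σ
  T-isMaxMatching⁻ {σ} h with Equivalence.to T-∧ h
  ... | all-involutive , one-fixed with length≡1⇒singleton (fixedPoints σ) (ℕP.≡ᵇ⇒≡ _ 1 one-fixed)
  ... | p , fp≡ = record
    { involutive   = λ i → T-does⁻ (app σ (app σ i) F.≟ i) (T-allB⁻ _ all-involutive (∈-allFin i))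
    ; fixed        = p
    ; fixedPoints≡ = fp≡ }

  T-isMaxMatching⁺ : ∀ {σ} → (∀ i → app σ (app σ i) ≡ i) → length (fixedPoints σ) ≡ 1 → T (isMaxMatching σ)
  T-isMaxMatching⁺ {σ} inv one-fixed = Equivalence.from T-∧
    (T-allB⁺ _ (allFin n) (λ {i} _ → T-does⁺ (app σ (app σ i) F.≟ i) (inv i)) , ℕP.≡⇒≡ᵇ _ 1 one-fixed)

  ∈-maxMatchings⁻ : ∀ {σ} → σ ∈ maxMatchings n → IsMaxMatching σ
  ∈-maxMatchings⁻ {σ} σ∈ = T-isMaxMatching⁻ (proj₂ (∈-filterᵇ⁻ isMaxMatching {xs = allVecs (allFin n) n} σ∈))

concatMap-cong-local : ∀ {A B : Set} {f g : A → List B} {xs} → All (λ x → f x ≡ g x) xs → concatMap f xs ≡ concatMap g xs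
concatMap-cong-local f≡g = cong concat (LP.map-cong-local f≡g)

module _ {n : ℕ} where

  block : Vec (Fin n) n → Fin n → List (Poly n)
  block σ l = (var l ⊕ var (app σ l)) ∷ (var l ⊖ var (app σ l)) ∷ []

  forms-focus : ∀ σ {l} → l ∈ leftEnds σ → ∃ λ rest →
                  forms σ ↭ block σ l ++ rest
                × ((g : Poly n → Poly n) → (∀ {l'} → l' ∈ leftEnds σ → l' ≢ l → L.map g (block σ l') ≡ block σ l') →
                   L.map g (forms σ) ↭ L.map g (block σ l) ++ rest)
  forms-focus σ l∈ with ls , leftEnds↭ , ls⊆ ← unique-focus (leftEnds-unique σ) l∈ =
    concatMap (block σ) ls , concatMap⁺ (block σ) leftEnds↭ , λ g g-fixes →
      ↭-trans (↭-reflexive (LP.map-concatMap g (block σ) (leftEnds σ)))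
        (↭-trans (concatMap⁺ (L.map g ∘ block σ) leftEnds↭)
          (++⁺ˡ (L.map g (block σ _)) (↭-reflexive (concatMap-cong-local
            (All.tabulate λ l'∈ → g-fixes (proj₁ (ls⊆ l'∈)) (proj₂ (ls⊆ l'∈)))))))

  reflect-block-avoiding : ∀ σ {i l} → l ≢ i → app σ l ≢ i → L.map (reflect i) (block σ l) ≡ block σ l
  reflect-block-avoiding σ {i} {l} l≢i σl≢i = cong₂ (λ u v → u ∷ v ∷ [])
    (trans (Reflection.mapP-⊕ i (var l) (var (app σ l))) (cong₂ _++_ (reflect-var-≢ l≢i) (reflect-var-≢ σl≢i)))
    (trans (Reflection.mapP-⊕ i (var l) (scale -1ℚ (var (app σ l))))
      (cong₂ _++_ (reflect-var-≢ l≢i) (trans (Reflection.mapP-scale i -1ℚ (var (app σ l))) (cong (scale -1ℚ) (reflect-var-≢ σl≢i)))))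

  reflect-block-left : ∀ σ {l} → app σ l ≢ l →
    L.map (reflect l) (block σ l) ≡ scale -1ℚ (var l ⊖ var (app σ l)) ∷ scale -1ℚ (var l ⊕ var (app σ l)) ∷ []
  reflect-block-left σ {l} σl≢l = cong₂ (λ u v → u ∷ v ∷ [])
    (trans (Reflection.mapP-⊕ l (var l) (var m)) (trans
      (cong₂ _++_ (reflect-var-≡ l) (trans (reflect-var-≢ σl≢l) (sym (scale-1-involutive (var m)))))
      (sym (scale-⊕ -1ℚ (var l) (scale -1ℚ (var m))))))
    (trans (Reflection.mapP-⊕ l (var l) (scale -1ℚ (var m))) (trans
      (cong₂ _++_ (reflect-var-≡ l) (trans (Reflection.mapP-scale l -1ℚ (var m)) (cong (scale -1ℚ) (reflect-var-≢ σl≢l))))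
      (sym (scale-⊕ -1ℚ (var l) (var m)))))
    where m = app σ l

  reflect-block-right : ∀ σ {l} → app σ l ≢ l →
    L.map (reflect (app σ l)) (block σ l) ≡ (var l ⊖ var (app σ l)) ∷ (var l ⊕ var (app σ l)) ∷ []
  reflect-block-right σ {l} σl≢l = cong₂ (λ u v → u ∷ v ∷ [])
    (trans (Reflection.mapP-⊕ m (var l) (var m)) (cong₂ _++_ (reflect-var-≢ l≢m) (reflect-var-≡ m)))
    (trans (Reflection.mapP-⊕ m (var l) (scale -1ℚ (var m))) (cong₂ _++_ (reflect-var-≢ l≢m)
      (trans (Reflection.mapP-scale m -1ℚ (var m)) (trans (cong (scale -1ℚ) (reflect-var-≡ m)) (scale-1-involutive (var m))))))
    where
    m = app σ l
    l≢m : l ≢ m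
    l≢m l≡m = σl≢l (sym l≡m)

  Tpoly-reflect-block : ∀ d σ {i l} rest → app σ l ≢ l → i ≡ l ⊎ i ≡ app σ l →
                        Tpoly d (L.map (reflect i) (block σ l) ++ rest) ↭ Tpoly d (block σ l ++ rest)
  Tpoly-reflect-block d σ {l = l} rest σl≢l (inj₁ refl) =
    ↭-trans (↭-reflexive (cong (λ bs → Tpoly d (bs ++ rest)) (reflect-block-left σ σl≢l)))
            (Tpoly-negate-swap-head d (var l ⊕ var (app σ l)) (var l ⊖ var (app σ l)) rest)
  Tpoly-reflect-block d σ {l = l} rest σl≢l (inj₂ refl) =
    ↭-trans (↭-reflexive (cong (λ bs → Tpoly d (bs ++ rest)) (reflect-block-right σ σl≢l)))
            (Tpoly-swap-head d (var l ⊕ var (app σ l)) (var l ⊖ var (app σ l)) rest)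

  Tpoly-reflect-edge : ∀ d {σ} → IsMaxMatching σ → ∀ {i l} → l ∈ leftEnds σ → i ≡ l ⊎ i ≡ app σ l →
                       Tpoly d (L.map (reflect i) (forms σ)) ↭ Tpoly d (forms σ)
  -- Arguments occurring only under Tpoly are supplied explicitly throughout: Tpoly is not injective, and
  -- inferring them makes Agda unfold it, which is prohibitively slow. For the same reason case splits on
  -- goals mentioning Tpoly go through local functions rather than 'with'.
  Tpoly-reflect-edge d {σ} M {i} {l} l∈ i∈edge =
    ↭-trans (Tpoly-↭ d {L.map (reflect i) (forms σ)} {L.map (reflect i) (block σ l) ++ rest}
                       (proj₂ (proj₂ focus) (reflect i) others-fixed))
      (↭-trans (Tpoly-reflect-block d σ {i} {l} rest σl≢l i∈edge)
               (Tpoly-↭ d {block σ l ++ rest} {forms σ} (↭-sym (proj₁ (proj₂ focus)))))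
    where
    module M = IsMaxMatching M
    focus = forms-focus σ l∈
    rest = proj₁ focus
    σl≢l : app σ l ≢ l
    σl≢l σl≡l = M.leftEnd≢fixed l∈ (M.fixed-unique σl≡l)
    others-fixed : ∀ {l'} → l' ∈ leftEnds σ → l' ≢ l → L.map (reflect i) (block σ l') ≡ block σ l'
    others-fixed l'∈ l'≢l with M.edges-disjoint l∈ l'∈ l'≢l i∈edge
    ... | l'≢i , σl'≢i = reflect-block-avoiding σ l'≢i σl'≢i

  reflect-fixed-forms : ∀ {σ} (M : IsMaxMatching σ) → L.map (reflect (IsMaxMatching.fixed M)) (forms σ) ≡ forms σ
  reflect-fixed-forms {σ} M = trans (LP.map-concatMap (reflect M.fixed) (block σ) (leftEnds σ)) (concatMap-cong-local
    (All.tabulate λ l∈ → reflect-block-avoiding σ (M.leftEnd≢fixed l∈) (M.partner≢fixed l∈)))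
    where module M = IsMaxMatching M

  Tpoly-reflect-forms : ∀ d σ → IsMaxMatching σ → ∀ i → Tpoly d (L.map (reflect i) (forms σ)) ↭ Tpoly d (forms σ)
  Tpoly-reflect-forms d σ M i = by-cases (app σ i F.≟ i)
    where
    by-cases : Dec (app σ i ≡ i) → Tpoly d (L.map (reflect i) (forms σ)) ↭ Tpoly d (forms σ)
    by-cases (yes σi≡i) = ↭-reflexive (trans (cong (λ j → Tpoly d (L.map (reflect j) (forms σ)))
                                                  (IsMaxMatching.fixed-unique M σi≡i))
                                            (cong (Tpoly d) (reflect-fixed-forms M)))
    by-cases (no σi≢i) = from-edge (IsMaxMatching.edge-leftEnd M σi≢i)
      where
      from-edge : (∃ λ l → l ∈ leftEnds σ × (i ≡ l ⊎ i ≡ app σ l)) → Tpoly d (L.map (reflect i) (forms σ)) ↭ Tpoly d (forms σ)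
      from-edge (l , l∈ , i∈edge) = Tpoly-reflect-edge d M {i} {l} l∈ i∈edge

reflect-Z : ∀ n d (i : Fin n) → reflect i (Z n d) ↭ Z n d
reflect-Z n d i = ↭-trans (↭-reflexive (Reflection.mapP-Z i d)) (scale-↭ (inv (2 ℕ.^ (d ℕ./ 2)))
  (concatMap-cong-↭ (maxMatchings n) (All.tabulate λ {σ} σ∈ →
    ↭-trans (↭-reflexive (Reflection.mapP-matchingTerm i d σ))
      (scale-↭ (matchingSign σ) (Tpoly-reflect-forms d σ (∈-maxMatchings⁻ σ∈) i)))))

module _ {n : ℕ} where

  FreeOf : Fin n → Poly n → Set
  FreeOf i = All (λ t → V.lookup (proj₂ t) i ≡ 0)

  FreeOf-⊕ : ∀ {i p q} → FreeOf i p → FreeOf i q → FreeOf i (p ⊕ q)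
  FreeOf-⊕ = AllP.++⁺

  FreeOf-scale : ∀ {i} c {p} → FreeOf i p → FreeOf i (scale c p)
  FreeOf-scale c = AllP.map⁺

  FreeOf-map-mulTerm : ∀ {i} t {q} → V.lookup (proj₂ t) i ≡ 0 → FreeOf i q → FreeOf i (L.map (mulTerm t) q)
  FreeOf-map-mulTerm     t {[]}     _  []        = []
  FreeOf-map-mulTerm {i} t {s ∷ q}  t₀ (s₀ ∷ q₀) =
    trans (VP.lookup-zipWith ℕ._+_ i (proj₂ t) (proj₂ s)) (cong₂ ℕ._+_ t₀ s₀) ∷ FreeOf-map-mulTerm t t₀ q₀

  FreeOf-⊗ : ∀ {i p q} → FreeOf i p → FreeOf i q → FreeOf i (p ⊗ q)
  FreeOf-⊗ {p = []}    []        _  = []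
  FreeOf-⊗ {p = t ∷ p} (t₀ ∷ p₀) q₀ = AllP.++⁺ (FreeOf-map-mulTerm t t₀ q₀) (FreeOf-⊗ p₀ q₀)

  FreeOf-oneP : ∀ {i} → FreeOf i oneP
  FreeOf-oneP {i} = VP.lookup-replicate i 0 ∷ []

  FreeOf-powP : ∀ {i x} k → FreeOf i x → FreeOf i (powP x k)
  FreeOf-powP zero    _  = FreeOf-oneP
  FreeOf-powP (suc k) x₀ = FreeOf-⊗ x₀ (FreeOf-powP k x₀)

  FreeOf-oddPowers : ∀ {i} rs {xs} → All (FreeOf i) xs → FreeOf i (prodP (zipWith oddPowerTerm rs xs))
  FreeOf-oddPowers []       _          = FreeOf-oneP
  FreeOf-oddPowers (r ∷ rs) []         = FreeOf-oneP
  FreeOf-oddPowers (r ∷ rs) (x₀ ∷ xs₀) =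
    FreeOf-⊗ (FreeOf-scale (inv (suc (2 ℕ.* r))) (FreeOf-powP (suc (2 ℕ.* r)) x₀)) (FreeOf-oddPowers rs xs₀)

  FreeOf-concatMap : ∀ {i} {A : Set} (f : A → Poly n) (xs : List A) → All (FreeOf i ∘ f) xs → FreeOf i (concatMap f xs)
  FreeOf-concatMap f []       []         = []
  FreeOf-concatMap f (x ∷ xs) (fx₀ ∷ h) = FreeOf-⊕ fx₀ (FreeOf-concatMap f xs h)

  FreeOf-Tpoly : ∀ {i} d {xs} → All (FreeOf i) xs → FreeOf i (Tpoly d xs)
  FreeOf-Tpoly {i} d {xs} xs₀ = Tform-rel (λ X _ → FreeOf i X) [] d (length xs) {xs} {xs} λ m →
    FreeOf-scale (cHalf m) (FreeOf-concatMap _ (comps m (length xs))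
      (All.universal (λ rs → FreeOf-scale (multinom m rs) (FreeOf-oddPowers rs xs₀)) _))

  FreeOf-var : ∀ {i j} → j ≢ i → FreeOf i (var j)
  FreeOf-var {i} {j} j≢i = trans (lookup-unit j i) (cong (λ b → if b then 1 else 0) (dec-false (j F.≟ i) j≢i)) ∷ []

  FreeOf-forms : ∀ {σ} (M : IsMaxMatching σ) → All (FreeOf (IsMaxMatching.fixed M)) (forms σ)
  FreeOf-forms {σ} M = AllP.concat⁺ (AllP.map⁺ (All.tabulate λ l∈ →
    let l₀ = FreeOf-var (M.leftEnd≢fixed l∈); σl₀ = FreeOf-var (M.partner≢fixed l∈)
    in FreeOf-⊕ l₀ σl₀ ∷ FreeOf-⊕ l₀ (FreeOf-scale -1ℚ σl₀) ∷ []))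
    where module M = IsMaxMatching M

  HasZeroExponent : Term n → Set
  HasZeroExponent t = ∃ λ i → V.lookup (proj₂ t) i ≡ 0

  FreeOf-matchingTerm : ∀ d {σ} (M : IsMaxMatching σ) → FreeOf (IsMaxMatching.fixed M) (matchingTerm d σ)
  FreeOf-matchingTerm d {σ} M = FreeOf-scale (matchingSign σ) (FreeOf-Tpoly d {forms σ} (FreeOf-forms M))

  Z-hasZeroExponents : ∀ d → All HasZeroExponent (Z n d)
  Z-hasZeroExponents d = AllP.map⁺ {f = scaleTerm (inv (2 ℕ.^ (d ℕ./ 2)))}
    (AllP.concat⁺ (AllP.map⁺ {f = matchingTerm d} (All.tabulate λ σ∈ →
      let M = ∈-maxMatchings⁻ σ∈ in All.map (IsMaxMatching.fixed M ,_) (FreeOf-matchingTerm d M))))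

coeff-Z-positive : ∀ n d (e : Mono n) → (∀ i → 0 < V.lookup e i) → coeff (Z n d) e ≡ 0ℚ
coeff-Z-positive n d e e>0 = coeff-vanishes (Z n d) e (All.map (λ {t} → e≢ {t}) (Z-hasZeroExponents d))
  where
  e≢ : ∀ {t : Term n} → HasZeroExponent t → e ≢ proj₂ t
  e≢ (i , t₀) e≡ = ℕP.<-irrefl (sym (trans (cong (λ f → V.lookup f i) e≡) t₀)) (e>0 i)

countᵇ : (A → Bool) → List A → ℕ
countᵇ p xs = length (filterᵇ p xs)

countᵇ-cons : (p : A → Bool) (x : A) (xs : List A) → countᵇ p (x ∷ xs) ≡ (if p x then suc (countᵇ p xs) else countᵇ p xs)
countᵇ-cons p x xs with p x
... | true  = refl
... | false = refl

signQ-countᵇ-xor : (P Q : A → Bool) (xs : List A) →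
                   signQ (countᵇ Q xs) ≡ signQ (countᵇ P xs) ℚ.* signQ (countᵇ (λ x → P x xor Q x) xs)
signQ-countᵇ-xor P Q []       = refl
signQ-countᵇ-xor P Q (x ∷ xs)
  rewrite countᵇ-cons P x xs | countᵇ-cons Q x xs | countᵇ-cons (λ x → P x xor Q x) x xs
  with P x | Q x | signQ-countᵇ-xor P Q xs
... | true  | true  | ih = trans (signQ-suc cQ) (trans (cong (-1ℚ ℚ.*_) ih)
                           (trans (sym (ℚP.*-assoc -1ℚ sP sX)) (cong (ℚ._* sX) (sym (signQ-suc cP)))))
  where cP = countᵇ P xs; cQ = countᵇ Q xs; sP = signQ cP; sX = signQ (countᵇ (λ x → P x xor Q x) xs)
... | true  | false | ih = trans ih (trans (sym (ℚP.*-identityˡ (sP ℚ.* sX)))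
                           (trans (sym (*-interchange -1ℚ sP -1ℚ sX)) (sym (cong₂ ℚ._*_ (signQ-suc cP) (signQ-suc cX)))))
  where cP = countᵇ P xs; cX = countᵇ (λ x → P x xor Q x) xs; sP = signQ cP; sX = signQ cX
... | false | true  | ih = trans (signQ-suc cQ) (trans (cong (-1ℚ ℚ.*_) ih)
                           (trans (*-left-comm -1ℚ sP sX) (cong (sP ℚ.*_) (sym (signQ-suc cX)))))
  where cQ = countᵇ Q xs; cX = countᵇ (λ x → P x xor Q x) xs; sP = signQ (countᵇ P xs); sX = signQ cX
... | false | false | ih = ih

countᵇ-none : (p : A → Bool) (xs : List A) → (∀ {x} → x ∈ xs → p x ≡ false) → countᵇ p xs ≡ 0
countᵇ-none p []       _ = refl
countᵇ-none p (x ∷ xs) h rewrite countᵇ-cons p x xs | h (here refl) = countᵇ-none p xs (h ∘ there)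

countᵇ-unique : (p : A → Bool) {xs : List A} {x₀ : A} → Unique xs → x₀ ∈ xs → p x₀ ≡ true →
                (∀ {x} → x ∈ xs → p x ≡ true → x ≡ x₀) → countᵇ p xs ≡ 1
countᵇ-unique p {xs} {x₀} u x₀∈ px₀ only-x₀ =
  ↭-length (unique-↭ (UniqueP.filter⁺ (λ x → T? (p x)) u) ([] ∷ []) ⊆ ⊇)
  where
  ⊆ : ∀ {z} → z ∈ filterᵇ p xs → z ∈ x₀ ∷ []
  ⊆ z∈ with z∈xs , pz ← ∈-filterᵇ⁻ p {xs = xs} z∈ = here (only-x₀ z∈xs (Equivalence.to T-≡ pz))
  ⊇ : ∀ {z} → z ∈ x₀ ∷ [] → z ∈ filterᵇ p xs
  ⊇ (here refl) = ∈-filterᵇ⁺ p x₀∈ (Equivalence.from T-≡ px₀)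

countᵇ-map : (p : B → Bool) (f : A → B) (xs : List A) → countᵇ p (L.map f xs) ≡ countᵇ (p ∘ f) xs
countᵇ-map p f []       = refl
countᵇ-map p f (x ∷ xs) rewrite countᵇ-cons p (f x) (L.map f xs) | countᵇ-cons (p ∘ f) x xs | countᵇ-map p f xs = refl

countᵇ-cong : (p q : A → Bool) (xs : List A) → (∀ {x} → x ∈ xs → p x ≡ q x) → countᵇ p xs ≡ countᵇ q xs
countᵇ-cong p q []       _ = refl
countᵇ-cong p q (x ∷ xs) h rewrite countᵇ-cons p x xs | countᵇ-cons q x xs | h (here refl) | countᵇ-cong p q xs (h ∘ there) = refl

countᵇ-↭ : (p : A → Bool) {xs ys : List A} → xs ↭ ys → countᵇ p xs ≡ countᵇ p ys
countᵇ-↭ p xs↭ys = ↭-length (filter-↭ (λ x → T? (p x)) xs↭ys)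

map₂ : (A → A) → A × A → A × A
map₂ f (x , y) = f x , f y

cartesianProduct-map : (f : A → A) (xs ys : List A) →
                       cartesianProduct (L.map f xs) (L.map f ys) ≡ L.map (map₂ f) (cartesianProduct xs ys)
cartesianProduct-map f []       ys = refl
cartesianProduct-map f (x ∷ xs) ys = trans (cong₂ _++_ (trans (sym (LP.map-∘ ys)) (LP.map-∘ ys)) (cartesianProduct-map f xs ys))
  (sym (LP.map-++ (map₂ f) (L.map (x ,_) ys) (cartesianProduct xs ys)))

cartesianProduct-↭ˡ : {xs xs' : List A} (ys : List A) → xs ↭ xs' → cartesianProduct xs ys ↭ cartesianProduct xs' ys
cartesianProduct-↭ˡ ys _↭_.refl        = ↭-refl
cartesianProduct-↭ˡ ys (prep x p)      = ++⁺ˡ (L.map (x ,_) ys) (cartesianProduct-↭ˡ ys p)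
cartesianProduct-↭ˡ ys (swap x y p)    = ↭-trans (shifts (L.map (x ,_) ys) (L.map (y ,_) ys))
  (++⁺ˡ (L.map (y ,_) ys) (++⁺ˡ (L.map (x ,_) ys) (cartesianProduct-↭ˡ ys p)))
cartesianProduct-↭ˡ ys (_↭_.trans p q) = ↭-trans (cartesianProduct-↭ˡ ys p) (cartesianProduct-↭ˡ ys q)

cartesianProduct-↭ʳ : (xs : List A) {ys ys' : List A} → ys ↭ ys' → cartesianProduct xs ys ↭ cartesianProduct xs ys'
cartesianProduct-↭ʳ []       _   = ↭-refl
cartesianProduct-↭ʳ (x ∷ xs) ys↭ = ++⁺ (map⁺ (x ,_) ys↭) (cartesianProduct-↭ʳ xs ys↭)

cartesianProduct-↭ : {xs xs' ys ys' : List A} → xs ↭ xs' → ys ↭ ys' → cartesianProduct xs ys ↭ cartesianProduct xs' ys'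
cartesianProduct-↭ {xs' = xs'} {ys} xs↭ ys↭ = ↭-trans (cartesianProduct-↭ˡ ys xs↭) (cartesianProduct-↭ʳ xs' ys↭)

-- The adjacent transposition (k k+1) and conjugation of matchings by it

allVecs-unique : ∀ {A : Set} {xs : List A} → Unique xs → ∀ m → Unique (allVecs xs m)
allVecs-unique u zero    = [] ∷ []
allVecs-unique u (suc m) = unique-taggedUnion V._∷_ VP.∷-injective (λ _ → allVecs _ m) _ u (λ _ → allVecs-unique u m)

∈-allVecs : ∀ {A : Set} {xs : List A} → (∀ x → x ∈ xs) → ∀ {m} (v : Vec A m) → v ∈ allVecs xs m
∈-allVecs all V.[]       = here refl
∈-allVecs {xs = xs} all {suc m} (x V.∷ v) =
  ∈-concatMap⁺ (λ x → L.map (x V.∷_) (allVecs xs m)) {xs = xs} (lose (all x) (∈-map⁺ (x V.∷_) (∈-allVecs all v)))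

maxMatchings-unique : ∀ n → Unique (maxMatchings n)
maxMatchings-unique n = UniqueP.filter⁺ (λ σ → T? (isMaxMatching σ)) (allVecs-unique (UniqueP.allFin⁺ n) n)

∈-maxMatchings⁺ : ∀ {n} {σ : Vec (Fin n) n} → T (isMaxMatching σ) → σ ∈ maxMatchings n
∈-maxMatchings⁺ {n} {σ} = ∈-filterᵇ⁺ isMaxMatching (∈-allVecs ∈-allFin σ)

<ᵇ-irrefl : ∀ m → (m <ᵇ m) ≡ false
<ᵇ-irrefl zero    = refl
<ᵇ-irrefl (suc m) = <ᵇ-irrefl m

<ᵇ-ext : ∀ {m m' n n'} → (m < m' → n < n') → (n < n' → m < m') → (m <ᵇ m') ≡ (n <ᵇ n')
<ᵇ-ext {m} {m'} {n} {n'} to from with m <ᵇ m' in eq₁ | n <ᵇ n' in eq₂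
... | false | false = refl
... | true  | true  = refl
... | true  | false = ⊥-elim (subst T eq₂ (ℕP.<⇒<ᵇ (to (ℕP.<ᵇ⇒< m m' (subst T (sym eq₁) tt)))))
... | false | true  = ⊥-elim (subst T eq₁ (ℕP.<⇒<ᵇ (from (ℕP.<ᵇ⇒< n n' (subst T (sym eq₂) tt)))))

<ᵇ-suc-left : ∀ k m → m ≢ k → m ≢ suc k → (suc k <ᵇ m) ≡ (k <ᵇ m)
<ᵇ-suc-left k m m≢k m≢k+1 = <ᵇ-ext (ℕP.<-trans (ℕP.n<1+n k)) (λ k<m → ℕP.≤∧≢⇒< k<m (m≢k+1 ∘ sym))

<ᵇ-suc-right : ∀ k m → m ≢ k → m ≢ suc k → (m <ᵇ suc k) ≡ (m <ᵇ k)
<ᵇ-suc-right k m m≢k m≢k+1 = <ᵇ-ext (λ m<k+1 → ℕP.≤∧≢⇒< (ℕP.≤-pred m<k+1) m≢k) (λ m<k → ℕP.<-trans m<k (ℕP.n<1+n k))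

<ᵇ-true : ∀ {m m'} → m < m' → (m <ᵇ m') ≡ true
<ᵇ-true m<m' = Equivalence.to T-≡ (ℕP.<⇒<ᵇ m<m')

<ᵇ-false : ∀ {m m'} → m' ≤ m → (m <ᵇ m') ≡ false
<ᵇ-false {m} {m'} m'≤m with m <ᵇ m' in eq
... | false = refl
... | true  = ⊥-elim (ℕP.<⇒≱ (ℕP.<ᵇ⇒< m m' (subst T (sym eq) tt)) m'≤m)

true≢false : true ≢ false
true≢false ()

module AdjacentTransposition {n : ℕ} (k : ℕ) (k+1<n : suc k < n) where

  a b : Fin n
  a = F.fromℕ< (ℕP.<-trans (ℕP.n<1+n k) k+1<n)
  b = F.fromℕ< k+1<n

  toℕ-a : toℕ a ≡ k
  toℕ-a = FP.toℕ-fromℕ< (ℕP.<-trans (ℕP.n<1+n k) k+1<n)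

  toℕ-b : toℕ b ≡ suc k
  toℕ-b = FP.toℕ-fromℕ< k+1<n

  a≢b : a ≢ b
  a≢b a≡b = ℕP.<-irrefl (trans (sym toℕ-a) (trans (cong toℕ a≡b) toℕ-b)) (ℕP.n<1+n k)

  τ : Fin n → Fin n
  τ x = if does (x F.≟ a) then b else if does (x F.≟ b) then a else x

  τ-a : τ a ≡ b
  τ-a rewrite dec-true (a F.≟ a) refl = refl

  τ-b : τ b ≡ a
  τ-b rewrite dec-false (b F.≟ a) (a≢b ∘ sym) | dec-true (b F.≟ b) refl = refl

  τ-other : ∀ {x} → x ≢ a → x ≢ b → τ x ≡ x
  τ-other {x} x≢a x≢b rewrite dec-false (x F.≟ a) x≢a | dec-false (x F.≟ b) x≢b = refl

  τ-involutive : ∀ x → τ (τ x) ≡ x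
  τ-involutive x = by-cases (x F.≟ a) (x F.≟ b)
    where
    by-cases : Dec (x ≡ a) → Dec (x ≡ b) → τ (τ x) ≡ x
    by-cases (yes refl) _          = trans (cong τ τ-a) τ-b
    by-cases (no _)     (yes refl) = trans (cong τ τ-b) τ-a
    by-cases (no x≢a)   (no x≢b)   = trans (cong τ (τ-other x≢a x≢b)) (τ-other x≢a x≢b)

  τ-injective : ∀ {x y} → τ x ≡ τ y → x ≡ y
  τ-injective {x} {y} eq = trans (sym (τ-involutive x)) (trans (cong τ eq) (τ-involutive y))

  toℕ-≢k : ∀ {x} → x ≢ a → toℕ x ≢ k
  toℕ-≢k x≢a eq = x≢a (FP.toℕ-injective (trans eq (sym toℕ-a)))

  toℕ-≢k+1 : ∀ {x} → x ≢ b → toℕ x ≢ suc k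
  toℕ-≢k+1 x≢b eq = x≢b (FP.toℕ-injective (trans eq (sym toℕ-b)))

  τ-<ᵇ : ∀ s t → ¬ (s ≡ a × t ≡ b) → ¬ (s ≡ b × t ≡ a) → (toℕ (τ s) <ᵇ toℕ (τ t)) ≡ (toℕ s <ᵇ toℕ t)
  τ-<ᵇ s t ¬ab ¬ba = by-cases (s F.≟ a) (s F.≟ b) (t F.≟ a) (t F.≟ b)
    where
    by-cases : Dec (s ≡ a) → Dec (s ≡ b) → Dec (t ≡ a) → Dec (t ≡ b) → (toℕ (τ s) <ᵇ toℕ (τ t)) ≡ (toℕ s <ᵇ toℕ t)
    by-cases (yes refl) _ (yes refl) _ = trans (<ᵇ-irrefl (toℕ (τ a))) (sym (<ᵇ-irrefl (toℕ a)))
    by-cases (yes refl) _ (no _) (yes refl) = ⊥-elim (¬ab (refl , refl))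
    by-cases (yes refl) _ (no t≢a) (no t≢b) rewrite τ-a | τ-other t≢a t≢b | toℕ-a | toℕ-b =
      <ᵇ-suc-left k (toℕ t) (toℕ-≢k t≢a) (toℕ-≢k+1 t≢b)
    by-cases (no _) (yes refl) (yes refl) _ = ⊥-elim (¬ba (refl , refl))
    by-cases (no _) (yes refl) (no _) (yes refl) = trans (<ᵇ-irrefl (toℕ (τ b))) (sym (<ᵇ-irrefl (toℕ b)))
    by-cases (no _) (yes refl) (no t≢a) (no t≢b) rewrite τ-b | τ-other t≢a t≢b | toℕ-a | toℕ-b =
      sym (<ᵇ-suc-left k (toℕ t) (toℕ-≢k t≢a) (toℕ-≢k+1 t≢b))
    by-cases (no s≢a) (no s≢b) (yes refl) _ rewrite τ-a | τ-other s≢a s≢b | toℕ-a | toℕ-b =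
      <ᵇ-suc-right k (toℕ s) (toℕ-≢k s≢a) (toℕ-≢k+1 s≢b)
    by-cases (no s≢a) (no s≢b) (no _) (yes refl) rewrite τ-b | τ-other s≢a s≢b | toℕ-a | toℕ-b =
      sym (<ᵇ-suc-right k (toℕ s) (toℕ-≢k s≢a) (toℕ-≢k+1 s≢b))
    by-cases (no s≢a) (no s≢b) (no t≢a) (no t≢b) rewrite τ-other s≢a s≢b | τ-other t≢a t≢b = refl

  conj : Vec (Fin n) n → Vec (Fin n) n
  conj σ = V.tabulate (λ x → τ (app σ (τ x)))

  app-conj : ∀ σ x → app (conj σ) x ≡ τ (app σ (τ x))
  app-conj σ x = VP.lookup∘tabulate _ x

  app-conj-τ : ∀ σ x → app (conj σ) (τ x) ≡ τ (app σ x)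
  app-conj-τ σ x = trans (app-conj σ (τ x)) (cong (τ ∘ app σ) (τ-involutive x))

  conj-involutive : ∀ σ → conj (conj σ) ≡ σ
  conj-involutive σ = Vec-ext λ x → trans (app-conj (conj σ) x)
    (trans (cong τ (app-conj σ (τ x))) (trans (τ-involutive _) (cong (app σ) (τ-involutive x))))

  conj-injective : ∀ {σ ρ} → conj σ ≡ conj ρ → σ ≡ ρ
  conj-injective {σ} {ρ} eq = trans (sym (conj-involutive σ)) (trans (cong conj eq) (conj-involutive ρ))

  module _ {σ : Vec (Fin n) n} (M : IsMaxMatching σ) where
    private module M = IsMaxMatching M

    conj-involution : ∀ x → app (conj σ) (app (conj σ) x) ≡ x
    conj-involution x = begin
      app (conj σ) (app (conj σ) x)        ≡⟨ cong (app (conj σ)) (app-conj σ x) ⟩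
      app (conj σ) (τ (app σ (τ x)))       ≡⟨ app-conj-τ σ _ ⟩
      τ (app σ (app σ (τ x)))              ≡⟨ cong τ (M.involutive (τ x)) ⟩
      τ (τ x)                              ≡⟨ τ-involutive x ⟩
      x                                    ∎
      where open ≡-Reasoning

    conj-fixed-unique : ∀ {x} → app (conj σ) x ≡ x → x ≡ τ M.fixed
    conj-fixed-unique {x} eq = trans (sym (τ-involutive x)) (cong τ (M.fixed-unique
      (trans (sym (τ-involutive _)) (trans (cong τ (sym (app-conj σ x))) (cong τ eq)))))

    conj-fixed : app (conj σ) (τ M.fixed) ≡ τ M.fixed
    conj-fixed = trans (app-conj-τ σ M.fixed) (cong τ M.fixed-fixed)

    fixedPoints-conj : fixedPoints (conj σ) ↭ τ M.fixed ∷ []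
    fixedPoints-conj = unique-↭ (UniqueP.filter⁺ (λ i → app (conj σ) i F.≟ i) (UniqueP.allFin⁺ n)) ([] ∷ []) ⊆ ⊇
      where
      ⊆ : ∀ {z} → z ∈ fixedPoints (conj σ) → z ∈ τ M.fixed ∷ []
      ⊆ z∈ = here (conj-fixed-unique (proj₂ (∈-filter⁻ (λ i → app (conj σ) i F.≟ i) {xs = allFin n} z∈)))
      ⊇ : ∀ {z} → z ∈ τ M.fixed ∷ [] → z ∈ fixedPoints (conj σ)
      ⊇ (here refl) = ∈-filter⁺ (λ i → app (conj σ) i F.≟ i) (∈-allFin _) conj-fixed

    conj-isMaxMatching : T (isMaxMatching (conj σ))
    conj-isMaxMatching = T-isMaxMatching⁺ {σ = conj σ} conj-involution (↭-length fixedPoints-conj)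

    conj-maxMatching : IsMaxMatching (conj σ)
    conj-maxMatching = T-isMaxMatching⁻ {σ = conj σ} conj-isMaxMatching

    fixed-conj : IsMaxMatching.fixed conj-maxMatching ≡ τ M.fixed
    fixed-conj = conj-fixed-unique (IsMaxMatching.fixed-fixed conj-maxMatching)

  map-conj-maxMatchings : L.map conj (maxMatchings n) ↭ maxMatchings n
  map-conj-maxMatchings = unique-↭ (UniqueP.map⁺ conj-injective (maxMatchings-unique n)) (maxMatchings-unique n) ⊆ ⊇
    where
    ⊆ : ∀ {ρ} → ρ ∈ L.map conj (maxMatchings n) → ρ ∈ maxMatchings n
    ⊆ ρ∈ with σ , σ∈ , refl ← ∈-map⁻ conj ρ∈ = ∈-maxMatchings⁺ {σ = conj σ} (conj-isMaxMatching (∈-maxMatchings⁻ σ∈))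
    ⊇ : ∀ {ρ} → ρ ∈ maxMatchings n → ρ ∈ L.map conj (maxMatchings n)
    ⊇ {ρ} ρ∈ = subst (_∈ L.map conj (maxMatchings n)) (conj-involutive ρ)
      (∈-map⁺ conj (∈-maxMatchings⁺ {σ = conj ρ} (conj-isMaxMatching (∈-maxMatchings⁻ ρ∈))))

  conj-self : ∀ {σ} → IsMaxMatching σ → app σ a ≡ b → conj σ ≡ σ
  conj-self {σ} M σa≡b = Vec-ext λ x → trans (app-conj σ x) (by-cases x (x F.≟ a) (x F.≟ b))
    where
    module M = IsMaxMatching M
    σb≡a : app σ b ≡ a
    σb≡a = sym (M.partner-≡ σa≡b)
    by-cases : ∀ x → Dec (x ≡ a) → Dec (x ≡ b) → τ (app σ (τ x)) ≡ app σ x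
    by-cases x (yes refl) _          = trans (cong (τ ∘ app σ) τ-a) (trans (cong τ σb≡a) (trans τ-a (sym σa≡b)))
    by-cases x (no _)     (yes refl) = trans (cong (τ ∘ app σ) τ-b) (trans (cong τ σa≡b) (trans τ-b (sym σb≡a)))
    by-cases x (no x≢a)   (no x≢b)   = trans (cong (τ ∘ app σ) (τ-other x≢a x≢b))
      (τ-other (λ σx≡a → x≢b (trans (M.partner-≡ σx≡a) σa≡b)) (λ σx≡b → x≢a (trans (M.partner-≡ σx≡b) σb≡a)))

  isLeftEnd-conj : ∀ {σ} → IsMaxMatching σ → app σ a ≢ b → ∀ x → isLeftEnd (conj σ) x ≡ isLeftEnd σ (τ x)
  isLeftEnd-conj {σ} M σa≢b x = begin
    (toℕ x <ᵇ toℕ (app (conj σ) x))                ≡⟨ cong₂ (λ u v → toℕ u <ᵇ toℕ v) (sym (τ-involutive x)) (app-conj σ x) ⟩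
    (toℕ (τ (τ x)) <ᵇ toℕ (τ (app σ (τ x))))       ≡⟨ τ-<ᵇ (τ x) (app σ (τ x)) ¬ab ¬ba ⟩
    (toℕ (τ x) <ᵇ toℕ (app σ (τ x)))               ∎
    where
    open ≡-Reasoning
    ¬ab : ¬ (τ x ≡ a × app σ (τ x) ≡ b)
    ¬ab (τx≡a , σ≡b) = σa≢b (subst (λ z → app σ z ≡ b) τx≡a σ≡b)
    ¬ba : ¬ (τ x ≡ b × app σ (τ x) ≡ a)
    ¬ba (τx≡b , σ≡a) = σa≢b (sym (IsMaxMatching.partner-≡ M (subst (λ z → app σ z ≡ a) τx≡b σ≡a)))

  leftEnds-conj : ∀ {σ} → IsMaxMatching σ → app σ a ≢ b → leftEnds (conj σ) ↭ L.map τ (leftEnds σ)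
  leftEnds-conj {σ} M σa≢b = unique-↭ (leftEnds-unique (conj σ)) (UniqueP.map⁺ τ-injective (leftEnds-unique σ)) ⊆ ⊇
    where
    ⊆ : ∀ {z} → z ∈ leftEnds (conj σ) → z ∈ L.map τ (leftEnds σ)
    ⊆ {z} z∈ = subst (_∈ _) (τ-involutive z) (∈-map⁺ τ (∈-filterᵇ⁺ (isLeftEnd σ) (∈-allFin (τ z))
      (subst T (isLeftEnd-conj M σa≢b z) (proj₂ (∈-filterᵇ⁻ (isLeftEnd (conj σ)) {xs = allFin n} z∈)))))
    ⊇ : ∀ {z} → z ∈ L.map τ (leftEnds σ) → z ∈ leftEnds (conj σ)
    ⊇ z∈ with y , y∈ , refl ← ∈-map⁻ τ z∈ = ∈-filterᵇ⁺ (isLeftEnd (conj σ)) (∈-allFin (τ y))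
      (subst T (sym (trans (isLeftEnd-conj M σa≢b (τ y)) (cong (isLeftEnd σ) (τ-involutive y))))
        (proj₂ (∈-filterᵇ⁻ (isLeftEnd σ) {xs = allFin n} y∈)))

module CrossingParity {n : ℕ} (k : ℕ) (k+1<n : suc k < n) where
  open AdjacentTransposition k k+1<n

  crosses : Vec (Fin n) n → Fin n × Fin n → Bool
  crosses ρ (x , y) = (toℕ x <ᵇ toℕ y) ∧ ((toℕ y <ᵇ toℕ (app ρ x)) ∧ (toℕ (app ρ x) <ᵇ toℕ (app ρ y)))

  pairs : Vec (Fin n) n → List (Fin n × Fin n)
  pairs ρ = cartesianProduct (leftEnds ρ) (leftEnds ρ)

  crossesAfterτ : Vec (Fin n) n → Fin n × Fin n → Bool
  crossesAfterτ σ (x , y) = (toℕ (τ x) <ᵇ toℕ (τ y))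
                          ∧ ((toℕ (τ y) <ᵇ toℕ (τ (app σ x))) ∧ (toℕ (τ (app σ x)) <ᵇ toℕ (τ (app σ y))))

  crosses-conj : ∀ σ z → crosses (conj σ) (map₂ τ z) ≡ crossesAfterτ σ z
  crosses-conj σ (x , y) rewrite app-conj-τ σ x | app-conj-τ σ y = refl

  changes : Vec (Fin n) n → Fin n × Fin n → Bool
  changes σ z = crosses σ z xor crossesAfterτ σ z

  signQ-cross-conj : ∀ {σ} → IsMaxMatching σ → app σ a ≢ b →
                     signQ (cross (conj σ)) ≡ signQ (cross σ) ℚ.* signQ (countᵇ (changes σ) (pairs σ))
  signQ-cross-conj {σ} M σa≢b = trans (cong signQ cross-conj) (signQ-countᵇ-xor (crosses σ) (crossesAfterτ σ) (pairs σ))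
    where
    open ≡-Reasoning
    Ls = leftEnds σ
    cross-conj : cross (conj σ) ≡ countᵇ (crossesAfterτ σ) (pairs σ)
    cross-conj = begin
      countᵇ (crosses (conj σ)) (pairs (conj σ))                                ≡⟨ countᵇ-↭ (crosses (conj σ)) (cartesianProduct-↭ Ls↭ Ls↭) ⟩
      countᵇ (crosses (conj σ)) (cartesianProduct (L.map τ Ls) (L.map τ Ls))    ≡⟨ cong (countᵇ (crosses (conj σ))) (cartesianProduct-map τ Ls Ls) ⟩
      countᵇ (crosses (conj σ)) (L.map (map₂ τ) (pairs σ))                      ≡⟨ countᵇ-map (crosses (conj σ)) (map₂ τ) (pairs σ) ⟩
      countᵇ (crosses (conj σ) ∘ map₂ τ) (pairs σ)                              ≡⟨ countᵇ-cong _ _ (pairs σ) (λ {z} _ → crosses-conj σ z) ⟩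
      countᵇ (crossesAfterτ σ) (pairs σ)                                        ∎
      where Ls↭ = leftEnds-conj M σa≢b

  -- A crossing can only change if one of the three comparisons in it is between a and b.

  data Change (σ : Vec (Fin n) n) (x y : Fin n) : Set where
    xy-ab   : x ≡ a → y ≡ b → Change σ x y
    xy-ba   : x ≡ b → y ≡ a → Change σ x y
    yσx-ab  : y ≡ a → app σ x ≡ b → Change σ x y
    yσx-ba  : y ≡ b → app σ x ≡ a → Change σ x y
    σxσy-ab : app σ x ≡ a → app σ y ≡ b → Change σ x y
    σxσy-ba : app σ x ≡ b → app σ y ≡ a → Change σ x y

  Straddles : Fin n → Fin n → Set
  Straddles s t = (s ≡ a × t ≡ b) ⊎ (s ≡ b × t ≡ a)

  straddles? : ∀ s t → Dec (Straddles s t)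
  straddles? s t with s F.≟ a | t F.≟ b | s F.≟ b | t F.≟ a
  ... | yes s≡a | yes t≡b | _       | _       = yes (inj₁ (s≡a , t≡b))
  ... | _       | _       | yes s≡b | yes t≡a = yes (inj₂ (s≡b , t≡a))
  ... | no s≢a  | _       | no s≢b  | _       = no λ { (inj₁ (s≡a , _)) → s≢a s≡a ; (inj₂ (s≡b , _)) → s≢b s≡b }
  ... | no s≢a  | _       | yes _   | no t≢a  = no λ { (inj₁ (s≡a , _)) → s≢a s≡a ; (inj₂ (_ , t≡a)) → t≢a t≡a }
  ... | yes _   | no t≢b  | _       | no t≢a  = no λ { (inj₁ (_ , t≡b)) → t≢b t≡b ; (inj₂ (_ , t≡a)) → t≢a t≡a }
  ... | yes _   | no t≢b  | no s≢b  | yes _   = no λ { (inj₁ (_ , t≡b)) → t≢b t≡b ; (inj₂ (s≡b , _)) → s≢b s≡b }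

  τ-<ᵇ-apart : ∀ s t → ¬ Straddles s t → (toℕ (τ s) <ᵇ toℕ (τ t)) ≡ (toℕ s <ᵇ toℕ t)
  τ-<ᵇ-apart s t ¬st = τ-<ᵇ s t (¬st ∘ inj₁) (¬st ∘ inj₂)

  crossesAfterτ-apart : ∀ σ x y → ¬ Straddles x y → ¬ Straddles y (app σ x) → ¬ Straddles (app σ x) (app σ y) →
                        crossesAfterτ σ (x , y) ≡ crosses σ (x , y)
  crossesAfterτ-apart σ x y ¬xy ¬yσx ¬σxσy
    rewrite τ-<ᵇ-apart x y ¬xy | τ-<ᵇ-apart y (app σ x) ¬yσx | τ-<ᵇ-apart (app σ x) (app σ y) ¬σxσy = refl

  changes-apart : ∀ σ x y → ¬ Straddles x y → ¬ Straddles y (app σ x) → ¬ Straddles (app σ x) (app σ y) →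
                  changes σ (x , y) ≡ false
  changes-apart σ x y ¬xy ¬yσx ¬σxσy =
    trans (cong (crosses σ (x , y) xor_) (crossesAfterτ-apart σ x y ¬xy ¬yσx ¬σxσy)) (xor-same (crosses σ (x , y)))

  change : ∀ σ x y → changes σ (x , y) ≡ true → Change σ x y
  change σ x y changed with straddles? x y | straddles? y (app σ x) | straddles? (app σ x) (app σ y)
  ... | yes (inj₁ (p , q)) | _                  | _                  = xy-ab p q
  ... | yes (inj₂ (p , q)) | _                  | _                  = xy-ba p q
  ... | no _               | yes (inj₁ (p , q)) | _                  = yσx-ab p q
  ... | no _               | yes (inj₂ (p , q)) | _                  = yσx-ba p q
  ... | no _               | no _               | yes (inj₁ (p , q)) = σxσy-ab p q
  ... | no _               | no _               | yes (inj₂ (p , q)) = σxσy-ba p q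
  ... | no ¬xy             | no ¬yσx            | no ¬σxσy           =
    ⊥-elim (true≢false (trans (sym changed) (changes-apart σ x y ¬xy ¬yσx ¬σxσy)))

  module ChangeCount {σ : Vec (Fin n) n} (M : IsMaxMatching σ) (σa≢b : app σ a ≢ b) where
    private module M = IsMaxMatching M

    Ls = leftEnds σ
    u = app σ a
    v = app σ b

    pairs-unique : Unique (pairs σ)
    pairs-unique = UniqueP.cartesianProduct⁺ (leftEnds-unique σ) (leftEnds-unique σ)

    ∈-pairs⁻ : ∀ {x y} → (x , y) ∈ pairs σ → x ∈ Ls × y ∈ Ls
    ∈-pairs⁻ = ∈-cartesianProduct⁻ Ls Ls

    <σ : ∀ {x} → x ∈ Ls → toℕ x < toℕ (app σ x)
    <σ = ∈-leftEnds⁻ σ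

    ∉Ls : ∀ {x} → toℕ (app σ x) < toℕ x → x ∉ Ls
    ∉Ls σx<x x∈ = ℕP.<-asym (<σ x∈) σx<x

    unmatched-apart : ∀ {s t c} → s ≢ c → t ≢ c → c ≡ a ⊎ c ≡ b → ¬ Straddles s t
    unmatched-apart s≢c t≢c (inj₁ refl) (inj₁ (s≡a , _)) = s≢c s≡a
    unmatched-apart s≢c t≢c (inj₁ refl) (inj₂ (_ , t≡a)) = t≢c t≡a
    unmatched-apart s≢c t≢c (inj₂ refl) (inj₁ (_ , t≡b)) = t≢c t≡b
    unmatched-apart s≢c t≢c (inj₂ refl) (inj₂ (s≡b , _)) = s≢c s≡b

    changes-unmatched-ab : M.fixed ≡ a ⊎ M.fixed ≡ b → countᵇ (changes σ) (pairs σ) ≡ 0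
    changes-unmatched-ab p∈ab = countᵇ-none (changes σ) (pairs σ) λ { {x , y} xy∈ → no-change x y (∈-pairs⁻ xy∈) }
      where
      no-change : ∀ x y → x ∈ Ls × y ∈ Ls → changes σ (x , y) ≡ false
      no-change x y (x∈ , y∈) = changes-apart σ x y
        (unmatched-apart (M.leftEnd≢fixed x∈) (M.leftEnd≢fixed y∈) p∈ab)
        (unmatched-apart (M.leftEnd≢fixed y∈) (M.partner≢fixed x∈) p∈ab)
        (unmatched-apart (M.partner≢fixed x∈) (M.partner≢fixed y∈) p∈ab)

    module _ (p≢a : M.fixed ≢ a) (p≢b : M.fixed ≢ b) where

      u≢a : u ≢ a
      u≢a u≡a = p≢a (sym (M.fixed-unique u≡a))

      v≢b : v ≢ b
      v≢b v≡b = p≢b (sym (M.fixed-unique v≡b))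

      v≢a : v ≢ a
      v≢a v≡a = σa≢b (sym (M.partner-≡ v≡a))

      u≢v : u ≢ v
      u≢v u≡v = a≢b (M.injective u≡v)

      τ-u : τ u ≡ u
      τ-u = τ-other u≢a σa≢b

      τ-v : τ v ≡ v
      τ-v = τ-other v≢a v≢b

      k<k+1 : k < suc k
      k<k+1 = ℕP.n<1+n k

      k+1≮k : (suc k <ᵇ k) ≡ false
      k+1≮k = <ᵇ-false (ℕP.n≤1+n k)

      module BothLeft (a∈ : a ∈ Ls) (b∈ : b ∈ Ls) where

        k+1<u : suc k < toℕ u
        k+1<u = ℕP.≤∧≢⇒< (subst (_< toℕ u) toℕ-a (<σ a∈)) (toℕ-≢k+1 σa≢b ∘ sym)

        k+1<v : suc k < toℕ v
        k+1<v = subst (_< toℕ v) toℕ-b (<σ b∈)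

        changes-ab : changes σ (a , b) ≡ (toℕ u <ᵇ toℕ v)
        changes-ab rewrite τ-a | τ-b | toℕ-a | toℕ-b | <ᵇ-true k<k+1 | <ᵇ-true k+1<u | k+1≮k =
          xor-identityʳ (toℕ u <ᵇ toℕ v)

        changes-ba : changes σ (b , a) ≡ (toℕ v <ᵇ toℕ u)
        changes-ba rewrite τ-a | τ-b | τ-u | τ-v | toℕ-a | toℕ-b | <ᵇ-true k<k+1 | <ᵇ-true k+1<v | k+1≮k = refl

        only-ab-ba : ∀ {x y} → (x , y) ∈ pairs σ → changes σ (x , y) ≡ true → (x , y) ≡ (a , b) ⊎ (x , y) ≡ (b , a)
        only-ab-ba {x} {y} xy∈ changed with ∈-pairs⁻ xy∈ | change σ x y changed
        ... | _ | xy-ab refl refl = inj₁ refl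
        ... | _ | xy-ba refl refl = inj₂ refl
        ... | x∈ , _ | yσx-ab _ σx≡b  = ⊥-elim (M.partner∉leftEnds b∈ (subst (_∈ Ls) (M.partner-≡ σx≡b) x∈))
        ... | x∈ , _ | yσx-ba _ σx≡a  = ⊥-elim (M.partner∉leftEnds a∈ (subst (_∈ Ls) (M.partner-≡ σx≡a) x∈))
        ... | x∈ , _ | σxσy-ab σx≡a _ = ⊥-elim (M.partner∉leftEnds a∈ (subst (_∈ Ls) (M.partner-≡ σx≡a) x∈))
        ... | x∈ , _ | σxσy-ba σx≡b _ = ⊥-elim (M.partner∉leftEnds b∈ (subst (_∈ Ls) (M.partner-≡ σx≡b) x∈))

        count : countᵇ (changes σ) (pairs σ) ≡ 1
        count with ℕP.<-cmp (toℕ u) (toℕ v)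
        ... | tri≈ _ u≡v _ = ⊥-elim (u≢v (FP.toℕ-injective u≡v))
        ... | tri< u<v _ _ = countᵇ-unique (changes σ) pairs-unique (∈-cartesianProduct⁺ a∈ b∈) (trans changes-ab (<ᵇ-true u<v)) only
          where
          only : ∀ {z} → z ∈ pairs σ → changes σ z ≡ true → z ≡ (a , b)
          only z∈ changed with only-ab-ba z∈ changed
          ... | inj₁ z≡ab = z≡ab
          ... | inj₂ refl = ⊥-elim (true≢false (trans (sym changed) (trans changes-ba (<ᵇ-false (ℕP.<⇒≤ u<v)))))
        ... | tri> _ _ v<u = countᵇ-unique (changes σ) pairs-unique (∈-cartesianProduct⁺ b∈ a∈) (trans changes-ba (<ᵇ-true v<u)) only
          where
          only : ∀ {z} → z ∈ pairs σ → changes σ z ≡ true → z ≡ (b , a)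
          only z∈ changed with only-ab-ba z∈ changed
          ... | inj₁ refl = ⊥-elim (true≢false (trans (sym changed) (trans changes-ab (<ᵇ-false (ℕP.<⇒≤ v<u)))))
          ... | inj₂ z≡ba = z≡ba

      partner-left : ∀ {x} → x ∉ Ls → app σ x ≢ x → app σ x ∈ Ls × toℕ (app σ x) < toℕ x
      partner-left {x} x∉ σx≢x with ℕP.<-cmp (toℕ x) (toℕ (app σ x))
      ... | tri< x<σx _ _ = ⊥-elim (x∉ (∈-leftEnds⁺ σ x<σx))
      ... | tri≈ _ x≡σx _ = ⊥-elim (σx≢x (sym (FP.toℕ-injective x≡σx)))
      ... | tri> _ _ σx<x = ∈-leftEnds⁺ σ (subst (λ z → toℕ (app σ x) < toℕ z) (sym (M.involutive x)) σx<x) , σx<x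

      u-left : a ∉ Ls → u ∈ Ls × toℕ u < k
      u-left a∉ with partner-left a∉ u≢a
      ... | u∈ , u<a = u∈ , subst (toℕ u <_) toℕ-a u<a

      v-left : b ∉ Ls → v ∈ Ls × toℕ v < k
      v-left b∉ with partner-left b∉ v≢b
      ... | v∈ , v<b = v∈ , ℕP.≤∧≢⇒< (ℕP.≤-pred (subst (toℕ v <_) toℕ-b v<b)) (toℕ-≢k v≢a)

      module LeftRight (a∈ : a ∈ Ls) (b∉ : b ∉ Ls) where

        k+1<u : suc k < toℕ u
        k+1<u = ℕP.≤∧≢⇒< (subst (_< toℕ u) toℕ-a (<σ a∈)) (toℕ-≢k+1 σa≢b ∘ sym)

        v∈ = proj₁ (v-left b∉)
        v<k = proj₂ (v-left b∉)

        changes-va : changes σ (v , a) ≡ true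
        changes-va rewrite M.involutive b | τ-v | τ-a | τ-b | toℕ-a | toℕ-b | <ᵇ-true v<k | <ᵇ-true k<k+1 | <ᵇ-true k+1<u
                         | <ᵇ-true (ℕP.<-trans v<k k<k+1) | k+1≮k = refl

        count : countᵇ (changes σ) (pairs σ) ≡ 1
        count = countᵇ-unique (changes σ) pairs-unique (∈-cartesianProduct⁺ v∈ a∈) changes-va only
          where
          only : ∀ {z} → z ∈ pairs σ → changes σ z ≡ true → z ≡ (v , a)
          only {x , y} xy∈ changed with ∈-pairs⁻ xy∈ | change σ x y changed
          ... | _ , y∈ | xy-ab _ refl     = ⊥-elim (b∉ y∈)
          ... | x∈ , _ | xy-ba refl _     = ⊥-elim (b∉ x∈)
          ... | _      | yσx-ab y≡a σx≡b  = cong₂ _,_ (M.partner-≡ σx≡b) y≡a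
          ... | _ , y∈ | yσx-ba refl _    = ⊥-elim (b∉ y∈)
          ... | x∈ , _ | σxσy-ab σx≡a _   = ⊥-elim (M.partner∉leftEnds a∈ (subst (_∈ Ls) (M.partner-≡ σx≡a) x∈))
          ... | _ , y∈ | σxσy-ba _ σy≡a   = ⊥-elim (M.partner∉leftEnds a∈ (subst (_∈ Ls) (M.partner-≡ σy≡a) y∈))

      module RightLeft (a∉ : a ∉ Ls) (b∈ : b ∈ Ls) where

        k+1<v : suc k < toℕ v
        k+1<v = subst (_< toℕ v) toℕ-b (<σ b∈)

        u∈ = proj₁ (u-left a∉)
        u<k = proj₂ (u-left a∉)

        changes-ub : changes σ (u , b) ≡ true
        changes-ub rewrite M.involutive a | τ-u | τ-b | τ-a | τ-v | toℕ-a | toℕ-b | <ᵇ-true u<k | <ᵇ-true k<k+1 | <ᵇ-true k+1<v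
                         | <ᵇ-true (ℕP.<-trans u<k k<k+1) | k+1≮k = refl

        count : countᵇ (changes σ) (pairs σ) ≡ 1
        count = countᵇ-unique (changes σ) pairs-unique (∈-cartesianProduct⁺ u∈ b∈) changes-ub only
          where
          only : ∀ {z} → z ∈ pairs σ → changes σ z ≡ true → z ≡ (u , b)
          only {x , y} xy∈ changed with ∈-pairs⁻ xy∈ | change σ x y changed
          ... | x∈ , _ | xy-ab refl _     = ⊥-elim (a∉ x∈)
          ... | _ , y∈ | xy-ba _ refl     = ⊥-elim (a∉ y∈)
          ... | _ , y∈ | yσx-ab refl _    = ⊥-elim (a∉ y∈)
          ... | _      | yσx-ba y≡b σx≡a  = cong₂ _,_ (M.partner-≡ σx≡a) y≡b
          ... | _ , y∈ | σxσy-ab _ σy≡b   = ⊥-elim (M.partner∉leftEnds b∈ (subst (_∈ Ls) (M.partner-≡ σy≡b) y∈))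
          ... | x∈ , _ | σxσy-ba σx≡b _   = ⊥-elim (M.partner∉leftEnds b∈ (subst (_∈ Ls) (M.partner-≡ σx≡b) x∈))

      module BothRight (a∉ : a ∉ Ls) (b∉ : b ∉ Ls) where

        u∈ = proj₁ (u-left a∉)
        u<k = proj₂ (u-left a∉)
        v∈ = proj₁ (v-left b∉)
        v<k = proj₂ (v-left b∉)

        changes-uv : changes σ (u , v) ≡ (toℕ u <ᵇ toℕ v)
        changes-uv rewrite M.involutive a | M.involutive b | τ-u | τ-v | τ-a | τ-b | toℕ-a | toℕ-b | <ᵇ-true v<k
                         | <ᵇ-true k<k+1 | <ᵇ-true (ℕP.<-trans v<k k<k+1) | k+1≮k with toℕ u <ᵇ toℕ v
        ... | true  = refl
        ... | false = refl

        changes-vu : changes σ (v , u) ≡ (toℕ v <ᵇ toℕ u)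
        changes-vu rewrite M.involutive a | M.involutive b | τ-u | τ-v | τ-a | τ-b | toℕ-a | toℕ-b | <ᵇ-true u<k
                         | <ᵇ-true k<k+1 | <ᵇ-true (ℕP.<-trans u<k k<k+1) | k+1≮k with toℕ v <ᵇ toℕ u
        ... | true  = refl
        ... | false = refl

        only-uv-vu : ∀ {x y} → (x , y) ∈ pairs σ → changes σ (x , y) ≡ true → (x , y) ≡ (u , v) ⊎ (x , y) ≡ (v , u)
        only-uv-vu {x} {y} xy∈ changed with ∈-pairs⁻ xy∈ | change σ x y changed
        ... | x∈ , _ | xy-ab refl _       = ⊥-elim (a∉ x∈)
        ... | x∈ , _ | xy-ba refl _       = ⊥-elim (b∉ x∈)
        ... | _ , y∈ | yσx-ab refl _      = ⊥-elim (a∉ y∈)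
        ... | _ , y∈ | yσx-ba refl _      = ⊥-elim (b∉ y∈)
        ... | _      | σxσy-ab σx≡a σy≡b  = inj₁ (cong₂ _,_ (M.partner-≡ σx≡a) (M.partner-≡ σy≡b))
        ... | _      | σxσy-ba σx≡b σy≡a  = inj₂ (cong₂ _,_ (M.partner-≡ σx≡b) (M.partner-≡ σy≡a))

        count : countᵇ (changes σ) (pairs σ) ≡ 1
        count with ℕP.<-cmp (toℕ u) (toℕ v)
        ... | tri≈ _ u≡v _ = ⊥-elim (u≢v (FP.toℕ-injective u≡v))
        ... | tri< u<v _ _ = countᵇ-unique (changes σ) pairs-unique (∈-cartesianProduct⁺ u∈ v∈) (trans changes-uv (<ᵇ-true u<v)) only
          where
          only : ∀ {z} → z ∈ pairs σ → changes σ z ≡ true → z ≡ (u , v)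
          only z∈ changed with only-uv-vu z∈ changed
          ... | inj₁ z≡uv = z≡uv
          ... | inj₂ refl = ⊥-elim (true≢false (trans (sym changed) (trans changes-vu (<ᵇ-false (ℕP.<⇒≤ u<v)))))
        ... | tri> _ _ v<u = countᵇ-unique (changes σ) pairs-unique (∈-cartesianProduct⁺ v∈ u∈) (trans changes-vu (<ᵇ-true v<u)) only
          where
          only : ∀ {z} → z ∈ pairs σ → changes σ z ≡ true → z ≡ (v , u)
          only z∈ changed with only-uv-vu z∈ changed
          ... | inj₁ refl = ⊥-elim (true≢false (trans (sym changed) (trans changes-uv (<ᵇ-false (ℕP.<⇒≤ v<u)))))
          ... | inj₂ z≡vu = z≡vu

      changes-unmatched-other : countᵇ (changes σ) (pairs σ) ≡ 1
      changes-unmatched-other with ℕP.<-cmp (toℕ a) (toℕ u) | ℕP.<-cmp (toℕ b) (toℕ v)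
      ... | tri≈ _ a≡u _ | _            = ⊥-elim (u≢a (sym (FP.toℕ-injective a≡u)))
      ... | _            | tri≈ _ b≡v _ = ⊥-elim (v≢b (sym (FP.toℕ-injective b≡v)))
      ... | tri< a<u _ _ | tri< b<v _ _ = BothLeft.count (∈-leftEnds⁺ σ a<u) (∈-leftEnds⁺ σ b<v)
      ... | tri< a<u _ _ | tri> _ _ v<b = LeftRight.count (∈-leftEnds⁺ σ a<u) (∉Ls v<b)
      ... | tri> _ _ u<a | tri< b<v _ _ = RightLeft.count (∉Ls u<a) (∈-leftEnds⁺ σ b<v)
      ... | tri> _ _ u<a | tri> _ _ v<b = BothRight.count (∉Ls u<a) (∉Ls v<b)

-- Antisymmetry of Z_d under the adjacent transposition

matchingSign-fixed : ∀ {n} {ρ : Vec (Fin n) n} (M : IsMaxMatching ρ) →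
                     matchingSign ρ ≡ signQ (cross ρ) ℚ.* signQ (toℕ (IsMaxMatching.fixed M))
matchingSign-fixed {ρ = ρ} M rewrite IsMaxMatching.fixedPoints≡ M | ℕP.+-identityʳ (toℕ (IsMaxMatching.fixed M)) =
  signQ-+ (cross ρ) (toℕ (IsMaxMatching.fixed M))

module Antisymmetry {n : ℕ} (k : ℕ) (k+1<n : suc k < n) where
  open AdjacentTransposition k k+1<n
  open CrossingParity k k+1<n

  signQ-τ-moved : ∀ {x} → x ≡ a ⊎ x ≡ b → signQ (toℕ (τ x)) ≡ -1ℚ ℚ.* signQ (toℕ x)
  signQ-τ-moved (inj₁ refl) rewrite τ-a | toℕ-a | toℕ-b = signQ-suc k
  signQ-τ-moved (inj₂ refl) rewrite τ-b | toℕ-a | toℕ-b = sym (trans (cong (-1ℚ ℚ.*_) (signQ-suc k)) (-1*-1*q≡q (signQ k)))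

  -- Either the unmatched vertex moves between k and k+1, or exactly one crossing changes.
  signQ-changes-fixed : ∀ {σ} (M : IsMaxMatching σ) (σa≢b : app σ a ≢ b) → let p = IsMaxMatching.fixed M in
                        signQ (countᵇ (changes σ) (pairs σ)) ℚ.* signQ (toℕ (τ p)) ≡ -1ℚ ℚ.* signQ (toℕ p)
  signQ-changes-fixed {σ} M σa≢b = by-cases (p F.≟ a) (p F.≟ b)
    where
    p = IsMaxMatching.fixed M
    sΔ = signQ (countᵇ (changes σ) (pairs σ))
    moved : p ≡ a ⊎ p ≡ b → sΔ ℚ.* signQ (toℕ (τ p)) ≡ -1ℚ ℚ.* signQ (toℕ p)
    moved p∈ab = trans (cong (λ c → signQ c ℚ.* signQ (toℕ (τ p))) (ChangeCount.changes-unmatched-ab M σa≢b p∈ab))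
                       (trans (ℚP.*-identityˡ _) (signQ-τ-moved p∈ab))
    by-cases : Dec (p ≡ a) → Dec (p ≡ b) → sΔ ℚ.* signQ (toℕ (τ p)) ≡ -1ℚ ℚ.* signQ (toℕ p)
    by-cases (yes p≡a) _         = moved (inj₁ p≡a)
    by-cases (no _)    (yes p≡b) = moved (inj₂ p≡b)
    by-cases (no p≢a)  (no p≢b)  = cong₂ (λ c q → signQ c ℚ.* signQ (toℕ q))
      (ChangeCount.changes-unmatched-other M σa≢b p≢a p≢b) (τ-other p≢a p≢b)

  matchingSign-conj : ∀ {σ} (M : IsMaxMatching σ) → app σ a ≢ b → matchingSign (conj σ) ≡ -1ℚ ℚ.* matchingSign σ
  matchingSign-conj {σ} M σa≢b = begin
    matchingSign (conj σ)                                    ≡⟨ matchingSign-fixed M' ⟩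
    signQ (cross (conj σ)) ℚ.* signQ (toℕ (fixed M'))        ≡⟨ cong₂ ℚ._*_ (signQ-cross-conj M σa≢b) (cong (signQ ∘ toℕ) (fixed-conj M)) ⟩
    (sc ℚ.* sΔ) ℚ.* signQ (toℕ (τ p))                        ≡⟨ ℚP.*-assoc sc sΔ _ ⟩
    sc ℚ.* (sΔ ℚ.* signQ (toℕ (τ p)))                        ≡⟨ cong (sc ℚ.*_) (signQ-changes-fixed M σa≢b) ⟩
    sc ℚ.* (-1ℚ ℚ.* signQ (toℕ p))                           ≡⟨ *-left-comm sc -1ℚ _ ⟩
    -1ℚ ℚ.* (sc ℚ.* signQ (toℕ p))                           ≡⟨ cong (-1ℚ ℚ.*_) (matchingSign-fixed M) ⟨
    -1ℚ ℚ.* matchingSign σ                                   ∎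
    where
    open ≡-Reasoning
    open IsMaxMatching using (fixed)
    M' = conj-maxMatching M
    p = fixed M
    sc = signQ (cross σ)
    sΔ = signQ (countᵇ (changes σ) (pairs σ))

  relabel : Poly n → Poly n
  relabel = Renaming.mapP τ

  relabel-var : ∀ j → relabel (var j) ≡ var (τ j)
  relabel-var = Renaming-var τ-involutive

  relabel-block : ∀ σ l → L.map relabel (block σ l) ≡ block (conj σ) (τ l)
  relabel-block σ l = cong₂ (λ u v → u ∷ v ∷ [])
    (trans (Renaming.mapP-⊕ τ (var l) (var (app σ l))) (cong₂ _++_ (relabel-var l) (trans (relabel-var (app σ l)) σ-edge)))
    (trans (Renaming.mapP-⊕ τ (var l) (scale -1ℚ (var (app σ l)))) (cong₂ _++_ (relabel-var l)
      (trans (Renaming.mapP-scale τ -1ℚ (var (app σ l))) (cong (scale -1ℚ) (trans (relabel-var (app σ l)) σ-edge)))))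
    where
    σ-edge : var (τ (app σ l)) ≡ var (app (conj σ) (τ l))
    σ-edge = cong var (sym (app-conj-τ σ l))

  Tpoly-relabel-forms-matched : ∀ d {σ} → IsMaxMatching σ → app σ a ≡ b →
                             Tpoly d (L.map relabel (forms σ)) ↭ scale -1ℚ (Tpoly d (forms σ))
  Tpoly-relabel-forms-matched d {σ} M σa≡b =
    ↭-trans (Tpoly-↭ d {L.map relabel (forms σ)} {L.map relabel (block σ a) ++ rest} (proj₂ (proj₂ focus) relabel others-fixed))
      (↭-trans (Tpoly-cong d {L.map relabel (block σ a) ++ rest} {X ∷ scale -1ℚ Y ∷ rest}
                           (Pointwise.++⁺ swapped-block (Pointwise.refl ↭-refl)))
        (↭-trans (Tpoly-negate-second d X Y rest) (scale-↭ -1ℚ (Tpoly-↭ d {block σ a ++ rest} {forms σ} (↭-sym (proj₁ (proj₂ focus)))))))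
    where
    module M = IsMaxMatching M
    a∈ : a ∈ leftEnds σ
    a∈ = ∈-leftEnds⁺ σ (subst₂ _<_ (sym toℕ-a) (trans (sym toℕ-b) (cong toℕ (sym σa≡b))) (ℕP.n<1+n k))
    focus = forms-focus σ a∈
    rest = proj₁ focus
    X = var a ⊕ var (app σ a)
    Y = var a ⊖ var (app σ a)
    others-fixed : ∀ {l'} → l' ∈ leftEnds σ → l' ≢ a → L.map relabel (block σ l') ≡ block σ l'
    others-fixed {l'} l'∈ l'≢a with M.edges-disjoint a∈ l'∈ l'≢a (inj₁ refl) | M.edges-disjoint a∈ l'∈ l'≢a (inj₂ (sym σa≡b))
    ... | _ , σl'≢a | l'≢b , σl'≢b =
      trans (relabel-block σ l') (trans (cong (λ ρ → block ρ (τ l')) (conj-self M σa≡b)) (cong (block σ) (τ-other l'≢a l'≢b)))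
    swapped-block : Pointwise _↭_ (L.map relabel (block σ a)) (X ∷ scale -1ℚ Y ∷ [])
    swapped-block rewrite relabel-block σ a | conj-self M σa≡b | τ-a | σa≡b | sym (M.partner-≡ σa≡b) =
      swap _ _ ↭-refl ∷ swap _ _ ↭-refl ∷ []

  Tpoly-relabel-forms-unmatched : ∀ d {σ} → IsMaxMatching σ → app σ a ≢ b →
                                  Tpoly d (L.map relabel (forms σ)) ↭ Tpoly d (forms (conj σ))
  Tpoly-relabel-forms-unmatched d {σ} M σa≢b = Tpoly-↭ d {L.map relabel (forms σ)} {forms (conj σ)} (begin
    L.map relabel (forms σ)                               ≡⟨ LP.map-concatMap relabel (block σ) (leftEnds σ) ⟩
    concatMap (L.map relabel ∘ block σ) (leftEnds σ)      ≡⟨ LP.concatMap-cong (relabel-block σ) (leftEnds σ) ⟩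
    concatMap (block (conj σ) ∘ τ) (leftEnds σ)           ≡⟨ LP.concatMap-map (block (conj σ)) τ (leftEnds σ) ⟨
    concatMap (block (conj σ)) (L.map τ (leftEnds σ))     ↭⟨ concatMap⁺ (block (conj σ)) (↭-sym (leftEnds-conj M σa≢b)) ⟩
    forms (conj σ)                                        ∎)
    where open PermutationReasoning

  relabel-matchingTerm : ∀ d {σ} → IsMaxMatching σ → relabel (matchingTerm d σ) ↭ scale -1ℚ (matchingTerm d (conj σ))
  relabel-matchingTerm d {σ} M = by-cases (app σ a F.≟ b)
    where
    open ≡-Reasoning
    s = matchingSign σ
    Tconj = Tpoly d (forms (conj σ))
    by-cases : Dec (app σ a ≡ b) → relabel (matchingTerm d σ) ↭ scale -1ℚ (matchingTerm d (conj σ))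
    by-cases (yes σa≡b) = ↭-trans (↭-reflexive (Renaming.mapP-matchingTerm τ d σ)) (↭-trans
      (scale-↭ s (Tpoly-relabel-forms-matched d M σa≡b))
      (↭-reflexive (trans (scale-comm s -1ℚ (Tpoly d (forms σ))) (cong (λ ρ → scale -1ℚ (matchingTerm d ρ)) (sym (conj-self M σa≡b))))))
    by-cases (no σa≢b) = ↭-trans (↭-reflexive (Renaming.mapP-matchingTerm τ d σ)) (↭-trans
      (scale-↭ s (Tpoly-relabel-forms-unmatched d M σa≢b))
      (↭-reflexive (begin
        scale s Tconj                                  ≡⟨ cong (λ c → scale c Tconj) (-1*-1*q≡q s) ⟨
        scale (-1ℚ ℚ.* (-1ℚ ℚ.* s)) Tconj              ≡⟨ cong (λ c → scale (-1ℚ ℚ.* c) Tconj) (matchingSign-conj M σa≢b) ⟨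
        scale (-1ℚ ℚ.* matchingSign (conj σ)) Tconj    ≡⟨ scale-scale -1ℚ (matchingSign (conj σ)) Tconj ⟨
        scale -1ℚ (matchingTerm d (conj σ))            ∎)))

  relabel-Z : ∀ d → relabel (Z n d) ↭ scale -1ℚ (Z n d)
  relabel-Z d = begin
    relabel (Z n d)                                               ≡⟨ Renaming.mapP-Z τ d ⟩
    scale c (sumP (L.map (relabel ∘ matchingTerm d) mm))          ↭⟨ scale-↭ c (concatMap-cong-↭ mm (All.tabulate λ σ∈ →
                                                                       relabel-matchingTerm d (∈-maxMatchings⁻ σ∈))) ⟩
    scale c (sumP (L.map (scale -1ℚ ∘ matchingTerm d ∘ conj) mm)) ≡⟨ cong (scale c ∘ sumP) (LP.map-∘ mm) ⟩
    scale c (sumP (L.map (scale -1ℚ ∘ matchingTerm d) (L.map conj mm))) ↭⟨ scale-↭ c (concat⁺ (map⁺ (scale -1ℚ ∘ matchingTerm d) map-conj-maxMatchings)) ⟩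
    scale c (sumP (L.map (scale -1ℚ ∘ matchingTerm d) mm))        ≡⟨ cong (scale c ∘ sumP) (LP.map-∘ mm) ⟩
    scale c (sumP (L.map (scale -1ℚ) (L.map (matchingTerm d) mm))) ≡⟨ cong (scale c) (scale-sumP -1ℚ (L.map (matchingTerm d) mm)) ⟨
    scale c (scale -1ℚ (sumP (L.map (matchingTerm d) mm)))        ≡⟨ scale-comm c -1ℚ (sumP (L.map (matchingTerm d) mm)) ⟩
    scale -1ℚ (Z n d)                                             ∎
    where
    open PermutationReasoning
    mm = maxMatchings n
    c = inv (2 ℕ.^ (d ℕ./ 2))

  coeff-Z-antisymmetric : ∀ d e → coeff (Z n d) (permuteMono τ e) ≡ -1ℚ ℚ.* coeff (Z n d) e
  coeff-Z-antisymmetric d e = begin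
    coeff (Z n d) (permuteMono τ e)      ≡⟨ coeff-renaming τ-involutive (Z n d) e ⟨
    coeff (relabel (Z n d)) e            ≡⟨ coeff-↭ e (relabel-Z d) ⟩
    coeff (scale -1ℚ (Z n d)) e          ≡⟨ coeff-scale -1ℚ (Z n d) e ⟩
    -1ℚ ℚ.* coeff (Z n d) e              ∎
    where open ≡-Reasoning

-- Alternating coefficient functions vanish on ties

-1*q≡-q : ∀ q → -1ℚ ℚ.* q ≡ ℚ.- q
-1*q≡-q q = trans (sym (ℚP.neg-distribˡ-* 1ℚ q)) (cong ℚ.-_ (ℚP.*-identityˡ q))

q≡-1*q⇒q≡0 : ∀ q → q ≡ -1ℚ ℚ.* q → q ≡ 0ℚ
q≡-1*q⇒q≡0 q q≡-q with ℚP.<-cmp q 0ℚ | trans q≡-q (-1*q≡-q q)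
... | tri≈ _ q≡0 _ | _   = q≡0
... | tri< q<0 _ _ | q≡- = ⊥-elim (ℚP.<-asym q<0 (subst (0ℚ ℚ.<_) (sym q≡-) (ℚP.neg-antimono-< q<0)))
... | tri> _ _ q>0 | q≡- = ⊥-elim (ℚP.<-asym q>0 (subst (ℚ._< 0ℚ) (sym q≡-) (ℚP.neg-antimono-< q>0)))

-1*q≡0⇒q≡0 : ∀ q → -1ℚ ℚ.* q ≡ 0ℚ → q ≡ 0ℚ
-1*q≡0⇒q≡0 q eq = trans (sym (-1*-1*q≡q q)) (trans (cong (-1ℚ ℚ.*_) eq) (ℚP.*-zeroʳ -1ℚ))

m<n⇒n≡m+suc[n∸suc[m]] : ∀ {m m'} → m < m' → m' ≡ m ℕ.+ suc (m' ∸ suc m)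
m<n⇒n≡m+suc[n∸suc[m]] {m} {m'} m<m' = trans (sym (ℕP.m+[n∸m]≡n m<m')) (sym (ℕP.+-suc m (m' ∸ suc m)))

module _ {n : ℕ} (C : Mono n → ℚ)
  (alternating : ∀ k (k+1<n : suc k < n) e → C (permuteMono (AdjacentTransposition.τ k k+1<n) e) ≡ -1ℚ ℚ.* C e) where

  -- Induction on the gap j - i: relabelling by (j-1 j) moves a tie at (i , j) to (i , j-1).
  vanishes-on-tie-gap : ∀ g (e : Mono n) (i j : Fin n) → toℕ j ≡ toℕ i ℕ.+ suc g → V.lookup e i ≡ V.lookup e j → C e ≡ 0ℚ
  vanishes-on-tie-gap zero e i j j≡i+1 eᵢ≡eⱼ = q≡-1*q⇒q≡0 (C e) (trans (cong C (sym τe≡e)) (alternating k k+1<n e))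
    where
    k = toℕ i
    k+1<n : suc k < n
    k+1<n = subst (_< n) (trans j≡i+1 (ℕP.+-comm k 1)) (FP.toℕ<n j)
    open AdjacentTransposition k k+1<n
    a≡i : a ≡ i
    a≡i = FP.toℕ-injective toℕ-a
    b≡j : b ≡ j
    b≡j = FP.toℕ-injective (trans toℕ-b (sym (trans j≡i+1 (ℕP.+-comm k 1))))
    τe≡e : permuteMono τ e ≡ e
    τe≡e = Vec-ext λ l → trans (lookup-permuteMono τ e l) (by-cases l (l F.≟ a) (l F.≟ b))
      where
      by-cases : ∀ l → Dec (l ≡ a) → Dec (l ≡ b) → V.lookup e (τ l) ≡ V.lookup e l
      by-cases l (yes refl) _          = trans (cong (V.lookup e) (trans τ-a b≡j)) (sym (trans (cong (V.lookup e) a≡i) eᵢ≡eⱼ))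
      by-cases l (no _)     (yes refl) = trans (cong (V.lookup e) (trans τ-b a≡i)) (trans eᵢ≡eⱼ (cong (V.lookup e) (sym b≡j)))
      by-cases l (no l≢a)   (no l≢b)   = cong (V.lookup e) (τ-other l≢a l≢b)
  vanishes-on-tie-gap (suc g) e i j j≡ eᵢ≡eⱼ =
    -1*q≡0⇒q≡0 (C e) (trans (sym (alternating k k+1<n e)) (vanishes-on-tie-gap g e' i a toℕ-a e'ᵢ≡e'ₐ))
    where
    k = toℕ i ℕ.+ suc g
    toℕ-j : toℕ j ≡ suc k
    toℕ-j = trans j≡ (ℕP.+-suc (toℕ i) (suc g))
    k+1<n : suc k < n
    k+1<n = subst (_< n) toℕ-j (FP.toℕ<n j)
    open AdjacentTransposition k k+1<n
    b≡j : b ≡ j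
    b≡j = FP.toℕ-injective (trans toℕ-b (sym toℕ-j))
    i<k : toℕ i < k
    i<k = ℕP.m<m+n (toℕ i) (s≤s z≤n)
    i≢a : i ≢ a
    i≢a i≡a = ℕP.<-irrefl (trans (cong toℕ i≡a) toℕ-a) i<k
    i≢b : i ≢ b
    i≢b i≡b = ℕP.<-irrefl (trans (cong toℕ i≡b) toℕ-b) (ℕP.<-trans i<k (ℕP.n<1+n k))
    e' = permuteMono τ e
    e'ᵢ≡e'ₐ : V.lookup e' i ≡ V.lookup e' a
    e'ᵢ≡e'ₐ = begin
      V.lookup e' i        ≡⟨ lookup-permuteMono τ e i ⟩
      V.lookup e (τ i)     ≡⟨ cong (V.lookup e) (τ-other i≢a i≢b) ⟩
      V.lookup e i         ≡⟨ eᵢ≡eⱼ ⟩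
      V.lookup e j         ≡⟨ cong (V.lookup e) (trans (sym b≡j) (sym τ-a)) ⟩
      V.lookup e (τ a)     ≡⟨ lookup-permuteMono τ e a ⟨
      V.lookup e' a        ∎
      where open ≡-Reasoning

  vanishes-on-ties : ∀ (e : Mono n) (i j : Fin n) → i ≢ j → V.lookup e i ≡ V.lookup e j → C e ≡ 0ℚ
  vanishes-on-ties e i j i≢j eᵢ≡eⱼ with ℕP.<-cmp (toℕ i) (toℕ j)
  ... | tri≈ _ i≡j _ = ⊥-elim (i≢j (FP.toℕ-injective i≡j))
  ... | tri< i<j _ _ = vanishes-on-tie-gap (toℕ j ∸ suc (toℕ i)) e i j (m<n⇒n≡m+suc[n∸suc[m]] i<j) eᵢ≡eⱼ
  ... | tri> _ _ j<i = vanishes-on-tie-gap (toℕ i ∸ suc (toℕ j)) e j i (m<n⇒n≡m+suc[n∸suc[m]] j<i) (sym eᵢ≡eⱼ)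

mainTheorem6 : (n : ℕ) → 3 ≤ n → n % 2 ≡ 1 → (d : ℕ) →
      ((i : Fin n) (e : Mono n) → coeff (reflect i (Z n d)) e ≡ coeff (Z n d) e)
    × ((e : Mono n) → ((i : Fin n) → 0 < lookup e i) → coeff (Z n d) e ≡ 0ℚ)
    × ((e : Mono n) (i j : Fin n) → i ≢ j → lookup e i ≡ lookup e j → coeff (Z n d) e ≡ 0ℚ)
mainTheorem6 n _ _ d =
    (λ i e → coeff-↭ e (reflect-Z n d i))
  , coeff-Z-positive n d
  , vanishes-on-ties (coeff (Z n d)) (λ k k+1<n e → Antisymmetry.coeff-Z-antisymmetric k k+1<n d e)
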